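{- There is a function $\varepsilon(n)\to 0$ as $n\to\infty$ such that for every $n\in\mathbb{N}$ and every set $X\subseteq\mathcal{M}(n)$, $X$ contains at least $|X|/(2+\varepsilon(n))^n$ mutually crossing-similar matchings and at least $|X|/(4+\varepsilon(n))^n$ mutually nesting-similar matchings.
   Context: A matching on $[2n]$ is a partition of $[2n]$ into $n$ two-element blocks (edges); $\mathcal{M}(n)$ is the set of such matchings. $cr(M)$ ($ne(M)$) is the number of pairs of edges $A,B$ with $\min A<\min B<\max A<\max B$ (with $\min A<\min B<\max B<\max A$). For $M\in\mathcal{M}(m)$, its children are the matchings obtained by choosing $x\in\{2,\dots,2m+2\}$, relabeling the vertices of $M$ order-preservingly by $\{2,\dots,2m+2\}\setminus\{x\}$ and adding the edge $\{1,x\}$; $\mathcal{T}(M,0)=\{M\}$ and $\mathcal{T}(M,l+1)$ is the set of children of members of $\mathcal{T}(M,l)$. $M,N$ are crossing-similar if the multisets $\{cr(P):P\in\mathcal{T}(M,l)\}$ and $\{cr(P):P\in\mathcal{T}(N,l)\}$ coincide for all $l\ge 0$; nesting-similar is defined likewise with $ne$. -}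

module Defs where

open import Data.Bool using (Bool; true; false; if_then_else_; _∧_)
open import Data.Nat as ℕ using (ℕ; zero; suc; _∸_; _<ᵇ_; _≡ᵇ_)
open import Data.List using (List; []; _∷_; length; map; upTo; concatMap)
open import Data.Nat.ListAction using (sum)
open import Data.Integer using (+_)
open import Data.Rational using (ℚ; _/_; 1ℚ; _*_)
open import Data.List.Relation.Binary.Permutation.Propositional using (_↭_)
open import Relation.Binary.PropositionalEquality using (_≡_; _≢_)
open import Data.Product using (_×_)

-- Conventions: vertices of [2n] are 0-indexed as 0,…,2n-1 (vertex k here is
-- vertex k+1 of the paper).  A matching on [2n] is encoded by its partner list
-- L of length 2n: L[i] is the vertex matched with i.  This encoding is
-- canonical, so propositional equality of lists is equality of matchings.

at : List ℕ → ℕ → ℕ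
at []       _       = 0
at (x ∷ _)  zero    = x
at (_ ∷ xs) (suc i) = at xs i

IsMatching : ℕ → List ℕ → Set
IsMatching n L =
  length L ≡ 2 ℕ.* n ×
  (∀ i → i ℕ.< 2 ℕ.* n →
     (at L i ℕ.< 2 ℕ.* n) × (at L (at L i) ≡ i) × (at L i ≢ i))

countPairs : ℕ → (ℕ → ℕ → Bool) → ℕ
countPairs k P = sum (map (λ i → sum (map (λ j → if P i j then 1 else 0) (upTo k))) (upTo k))

cr : List ℕ → ℕ
cr L = countPairs (length L) (λ i j → (i <ᵇ j) ∧ (j <ᵇ at L i) ∧ (at L i <ᵇ at L j))

ne : List ℕ → ℕ
ne L = countPairs (length L) (λ i j → (i <ᵇ j) ∧ (j <ᵇ at L j) ∧ (at L j <ᵇ at L i))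

-- order-preserving relabelling of old vertex v onto {1,…,2m+1} \ {x}
shift : ℕ → ℕ → ℕ
shift x v = if suc v <ᵇ x then suc v else suc (suc v)

-- its inverse on new vertices w ∉ {0, x}
unshift : ℕ → ℕ → ℕ
unshift x w = if w <ᵇ x then w ∸ 1 else w ∸ 2

-- the child of L obtained by adding the edge {0, x} (x ∈ {1,…,2m+1};
-- paper: {1, x+1} with x+1 ∈ {2,…,2m+2})
child : List ℕ → ℕ → List ℕ
child L x = map (λ w → if w ≡ᵇ 0 then x else
                        (if w ≡ᵇ x then 0 else shift x (at L (unshift x w))))
                (upTo (suc (suc (length L))))

children : List ℕ → List (List ℕ)
children L = map (λ k → child L (suc k)) (upTo (suc (length L)))

-- 𝒯(M, l) as a list (its entries are pairwise distinct)
tree : List ℕ → ℕ → List (List ℕ)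
tree L zero    = L ∷ []
tree L (suc l) = concatMap children (tree L l)

-- equality of multisets of statistic values = permutation of value lists
CrossingSimilar : List ℕ → List ℕ → Set
CrossingSimilar L K = ∀ l → map cr (tree L l) ↭ map cr (tree K l)

NestingSimilar : List ℕ → List ℕ → Set
NestingSimilar L K = ∀ l → map ne (tree L l) ↭ map ne (tree K l)

ℕtoℚ : ℕ → ℚ
ℕtoℚ k = + k / 1

powℚ : ℚ → ℕ → ℚ
powℚ q zero    = 1ℚ
powℚ q (suc n) = q * powℚ q n

module Submission where

-- For a matching L on [2m] the child obtained by adding the arc {0, k+1} has
-- cr = cr L + h_k, where h_k is the number of arcs of L passing over the gap
-- before vertex k, and its gap heights arise from those of L by a fixed
-- insertion rule.  Expanding the crossing numbers of all level-l descendants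
-- as a polynomial in q, one gets q^(cr L) times an expression built from
-- complete homogeneous symmetric polynomials in the q^(h_k); hence the
-- crossing class of L is determined by cr L and the multiset of gap heights.
-- For a perfect matching on [2n] that multiset is {0} ∪ A ∪ (A + 1) with A a
-- down-closed multiset of size n, whose sorted form is a 0/1-step sequence:
-- at most ((2n)² + 1) · 2ⁿ crossing classes.  For nestings the role of the
-- heights is played by the sequence "number of arcs closed before vertex p",
-- a 0/1-step sequence of length 2n + 1, giving ((2n)² + 1) · 4ⁿ classes.
-- Pigeonhole and ((2n)² + 1)^(1/n) → 1 finish the proof.

module BoolArith where

  open import Data.Nat using (ℕ; zero; suc; _<_; _≤_; s≤s; _<ᵇ_; _≡ᵇ_)
  open import Data.Nat.Properties using (≡ᵇ⇒≡; <ᵇ⇒<)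
  open import Data.Bool using (Bool; true; false; if_then_else_; T)
  open import Data.Empty using (⊥-elim)
  open import Relation.Binary.PropositionalEquality using (_≡_; _≢_; refl; subst; sym)

  iverson : Bool → ℕ
  iverson b = if b then 1 else 0

  <ᵇ-true : ∀ {a b} → a < b → (a <ᵇ b) ≡ true
  <ᵇ-true {zero} {suc b} _ = refl
  <ᵇ-true {suc a} {suc b} (s≤s p) = <ᵇ-true p

  <ᵇ-false : ∀ {a b} → b ≤ a → (a <ᵇ b) ≡ false
  <ᵇ-false {a} {zero} _ = refl
  <ᵇ-false {suc a} {suc b} (s≤s p) = <ᵇ-false p

  ≡ᵇ-refl : ∀ n → (n ≡ᵇ n) ≡ true
  ≡ᵇ-refl zero = refl
  ≡ᵇ-refl (suc n) = ≡ᵇ-refl n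

  ≡ᵇ-true⇒≡ : ∀ {a b} → (a ≡ᵇ b) ≡ true → a ≡ b
  ≡ᵇ-true⇒≡ {a} {b} e = ≡ᵇ⇒≡ a b (subst T (sym e) _)

  ≢⇒≡ᵇ-false : ∀ {a b} → a ≢ b → (a ≡ᵇ b) ≡ false
  ≢⇒≡ᵇ-false {a} {b} a≢b with a ≡ᵇ b in eq
  ... | true = ⊥-elim (a≢b (≡ᵇ-true⇒≡ eq))
  ... | false = refl

  <ᵇ-true⇒< : ∀ {a b} → (a <ᵇ b) ≡ true → a < b
  <ᵇ-true⇒< {a} {b} e = <ᵇ⇒< a b (subst T (sym e) _)

module Relabelling where

  open import Data.Nat using (ℕ; suc; _<_; _≤_; s≤s; _<ᵇ_; _<?_)
  open import Data.Nat.Properties using (≮⇒≥; ≤-trans; <⇒≤; <-≤-trans; m≤n⇒m≤1+n; m<n⇒m<1+n)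
  open import Data.Bool using (true; not)
  open import Relation.Binary.PropositionalEquality using (_≡_; refl; sym; trans)
  open import Relation.Nullary using (yes; no)
  open import Defs using (shift)
  open BoolArith

  shift-below : ∀ {k v} → v < k → shift (suc k) v ≡ suc v
  shift-below p rewrite <ᵇ-true p = refl

  shift-above : ∀ {k v} → k ≤ v → shift (suc k) v ≡ suc (suc v)
  shift-above p rewrite <ᵇ-false p = refl

  data ShiftCase (k v : ℕ) : Set where
    below : v < k → shift (suc k) v ≡ suc v → ShiftCase k v
    above : k ≤ v → shift (suc k) v ≡ suc (suc v) → ShiftCase k v

  shiftCase : ∀ k v → ShiftCase k v
  shiftCase k v with v <? k
  ... | yes p = below p (shift-below p)
  ... | no p = above (≮⇒≥ p) (shift-above (≮⇒≥ p))

  module _ (k : ℕ) where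

    0<ᵇshift : ∀ w → (0 <ᵇ shift (suc k) w) ≡ true
    0<ᵇshift w with shiftCase k w
    ... | below _ e rewrite e = refl
    ... | above _ e rewrite e = refl

    shift<ᵇ1+k : ∀ w → (shift (suc k) w <ᵇ suc k) ≡ (w <ᵇ k)
    shift<ᵇ1+k w with shiftCase k w
    ... | below _ e rewrite e = refl
    ... | above p e rewrite e = trans (<ᵇ-false (m≤n⇒m≤1+n p)) (sym (<ᵇ-false p))

    1+k<ᵇshift : ∀ y → (suc k <ᵇ shift (suc k) y) ≡ not (y <ᵇ k)
    1+k<ᵇshift y with shiftCase k y
    ... | below p e rewrite e | <ᵇ-true p = <ᵇ-false (<⇒≤ p)
    ... | above p e rewrite e | <ᵇ-false p = <ᵇ-true (s≤s p)

    shift-<ᵇ : ∀ a b → (shift (suc k) a <ᵇ shift (suc k) b) ≡ (a <ᵇ b)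
    shift-<ᵇ a b with shiftCase k a | shiftCase k b
    ... | below pa ea | below pb eb rewrite ea | eb = refl
    ... | below pa ea | above pb eb rewrite ea | eb =
      trans (<ᵇ-true (≤-trans pa (m≤n⇒m≤1+n pb))) (sym (<ᵇ-true (<-≤-trans pa pb)))
    ... | above pa ea | below pb eb rewrite ea | eb =
      trans (<ᵇ-false (m≤n⇒m≤1+n (≤-trans (<⇒≤ pb) pa))) (sym (<ᵇ-false (≤-trans (<⇒≤ pb) pa)))
    ... | above pa ea | above pb eb rewrite ea | eb = refl

    shift<ᵇ-low : ∀ v w → w ≤ k → (shift (suc k) v <ᵇ suc w) ≡ (v <ᵇ w)
    shift<ᵇ-low v w w≤k with shiftCase k v
    ... | below _ e rewrite e = refl
    ... | above p e rewrite e = trans (<ᵇ-false (m≤n⇒m≤1+n (≤-trans w≤k p))) (sym (<ᵇ-false (≤-trans w≤k p)))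

    shift<ᵇ-high : ∀ v w → k ≤ w → (shift (suc k) v <ᵇ suc (suc w)) ≡ (v <ᵇ w)
    shift<ᵇ-high v w k≤w with shiftCase k v
    ... | below p e rewrite e = trans (<ᵇ-true (m<n⇒m<1+n (<-≤-trans p k≤w))) (sym (<ᵇ-true (<-≤-trans p k≤w)))
    ... | above _ e rewrite e = refl

    shift<2+len : ∀ len v → v < len → shift (suc k) v < suc (suc len)
    shift<2+len len v p with shiftCase k v
    ... | below _ e rewrite e = s≤s (m≤n⇒m≤1+n p)
    ... | above _ e rewrite e = s≤s (s≤s p)

module FiniteSums where

  open import Data.Nat using (ℕ; zero; suc; _+_; _*_; _∸_; _<_; _≤_; z≤n; s≤s)
  open import Data.Nat.Properties
  open import Data.Bool using (Bool; true; false)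
  open import Data.List using (map; upTo; applyUpTo)
  open import Data.Nat.ListAction using (sum)
  open import Relation.Binary.PropositionalEquality using (_≡_; _≢_; refl; cong; cong₂; sym; trans; module ≡-Reasoning)
  open import Function using (_∘_)
  open import Data.Nat.Solver using (module +-*-Solver)
  open +-*-Solver using (solve; _:+_; _:=_)
  open import Defs using (shift)
  open BoolArith
  open Relabelling

  ∑ : ℕ → (ℕ → ℕ) → ℕ
  ∑ zero f = 0
  ∑ (suc m) f = f 0 + ∑ m (f ∘ suc)

  sum-applyUpTo : ∀ m (f g : ℕ → ℕ) → sum (map f (applyUpTo g m)) ≡ ∑ m (f ∘ g)
  sum-applyUpTo zero f g = refl
  sum-applyUpTo (suc m) f g = cong (f (g 0) +_) (sum-applyUpTo m f (g ∘ suc))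

  sum-map-upTo : ∀ m f → sum (map f (upTo m)) ≡ ∑ m f
  sum-map-upTo m f = sum-applyUpTo m f (λ x → x)

  ∑-cong : ∀ m {f g : ℕ → ℕ} → (∀ i → i < m → f i ≡ g i) → ∑ m f ≡ ∑ m g
  ∑-cong zero e = refl
  ∑-cong (suc m) e = cong₂ _+_ (e 0 (s≤s z≤n)) (∑-cong m (λ i i<m → e (suc i) (s≤s i<m)))

  ∑-zero : ∀ m {f : ℕ → ℕ} → (∀ i → i < m → f i ≡ 0) → ∑ m f ≡ 0
  ∑-zero zero e = refl
  ∑-zero (suc m) e = cong₂ _+_ (e 0 (s≤s z≤n)) (∑-zero m (λ i i<m → e (suc i) (s≤s i<m)))

  ∑-single : ∀ m a (f : ℕ → ℕ) → a < m → (∀ j → j < m → j ≢ a → f j ≡ 0) → ∑ m f ≡ f a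
  ∑-single (suc m) zero f _ z = trans (cong (f 0 +_) (∑-zero m (λ j j< → z (suc j) (s≤s j<) (λ ())))) (+-identityʳ (f 0))
  ∑-single (suc m) (suc a) f (s≤s a<) z = trans (cong (_+ ∑ m (f ∘ suc)) (z 0 (s≤s z≤n) (λ ())))
    (∑-single m a (f ∘ suc) a< (λ j j< j≢a → z (suc j) (s≤s j<) (λ e → j≢a (suc-injective e))))

  ∑-split : ∀ a b f → ∑ (a + b) f ≡ ∑ a f + ∑ b (f ∘ (a +_))
  ∑-split zero b f = refl
  ∑-split (suc a) b f = trans (cong (f 0 +_) (∑-split a b (f ∘ suc))) (sym (+-assoc (f 0) (∑ a (f ∘ suc)) _))

  ∑-+ : ∀ m f g → ∑ m (λ i → f i + g i) ≡ ∑ m f + ∑ m g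
  ∑-+ zero f g = refl
  ∑-+ (suc m) f g = trans (cong (f 0 + g 0 +_) (∑-+ m (f ∘ suc) (g ∘ suc)))
    (solve 4 (λ a b c d → a :+ b :+ (c :+ d) := a :+ c :+ (b :+ d)) refl (f 0) (g 0) (∑ m (f ∘ suc)) (∑ m (g ∘ suc)))

  ∑-iverson≤ : ∀ m (f : ℕ → Bool) → ∑ m (λ i → iverson (f i)) ≤ m
  ∑-iverson≤ zero f = z≤n
  ∑-iverson≤ (suc m) f with f 0
  ... | true = s≤s (∑-iverson≤ m (f ∘ suc))
  ... | false = m≤n⇒m≤1+n (∑-iverson≤ m (f ∘ suc))

  ∑-bounded : ∀ m b (f : ℕ → ℕ) → (∀ i → f i ≤ b) → ∑ m f ≤ m * b
  ∑-bounded zero b f h = z≤n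
  ∑-bounded (suc m) b f h = +-mono-≤ (h 0) (∑-bounded m b (f ∘ suc) (h ∘ suc))

  ∑-remove-two : ∀ len k → k ≤ len → (f : ℕ → ℕ) →
    ∑ (suc (suc len)) f ≡ f 0 + f (suc k) + ∑ len (f ∘ shift (suc k))
  ∑-remove-two len k k≤len f = begin
    f 0 + ∑ (suc len) (f ∘ suc)
      ≡⟨ cong (λ z → f 0 + ∑ z (f ∘ suc)) len+1≡k+[r+1] ⟩
    f 0 + ∑ (k + suc r) (f ∘ suc)
      ≡⟨ cong (f 0 +_) (∑-split k (suc r) (f ∘ suc)) ⟩
    f 0 + (∑ k (f ∘ suc) + (f (suc (k + 0)) + ∑ r (λ i → f (suc (k + suc i)))))
      ≡⟨ cong (λ z → f 0 + (∑ k (f ∘ suc) + (f (suc z) + ∑ r (λ i → f (suc (k + suc i)))))) (+-identityʳ k) ⟩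
    f 0 + (∑ k (f ∘ suc) + (f (suc k) + ∑ r (λ i → f (suc (k + suc i)))))
      ≡⟨ solve 4 (λ a b c d → a :+ (b :+ (c :+ d)) := a :+ c :+ (b :+ d))
           refl (f 0) (∑ k (f ∘ suc)) (f (suc k)) (∑ r (λ i → f (suc (k + suc i)))) ⟩
    f 0 + f (suc k) + (∑ k (f ∘ suc) + ∑ r (λ i → f (suc (k + suc i))))
      ≡⟨ cong (f 0 + f (suc k) +_) (cong₂ _+_ lower upper) ⟩
    f 0 + f (suc k) + (∑ k (f ∘ shift (suc k)) + ∑ r (λ i → f (shift (suc k) (k + i))))
      ≡⟨ cong (f 0 + f (suc k) +_) (sym (∑-split k r (f ∘ shift (suc k)))) ⟩
    f 0 + f (suc k) + ∑ (k + r) (f ∘ shift (suc k))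
      ≡⟨ cong (λ z → f 0 + f (suc k) + ∑ z (f ∘ shift (suc k))) (m+[n∸m]≡n k≤len) ⟩
    f 0 + f (suc k) + ∑ len (f ∘ shift (suc k)) ∎
    where
    open ≡-Reasoning
    r = len ∸ k
    len+1≡k+[r+1] : suc len ≡ k + suc r
    len+1≡k+[r+1] = trans (cong suc (sym (m+[n∸m]≡n k≤len))) (sym (+-suc k r))
    lower : ∑ k (f ∘ suc) ≡ ∑ k (f ∘ shift (suc k))
    lower = ∑-cong k (λ i i<k → cong f (sym (shift-below i<k)))
    upper : ∑ r (λ i → f (suc (k + suc i))) ≡ ∑ r (λ i → f (shift (suc k) (k + i)))
    upper = ∑-cong r (λ i _ → cong f (trans (cong suc (+-suc k i)) (sym (shift-above (m≤m+n k i)))))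

module ListLookup where

  open import Data.Nat using (ℕ; zero; suc; _+_; _<_; _≤_; z≤n; s≤s)
  open import Data.Nat.Properties using (suc-injective)
  open import Data.List using (List; []; _∷_; _++_; map; take; drop; length; upTo; applyUpTo)
  open import Data.List.Properties using (length-map; length-applyUpTo)
  open import Relation.Binary.PropositionalEquality using (_≡_; refl; cong; cong₂; trans)
  open import Function using (_∘_)
  open import Defs using (at)

  at-ext : ∀ (xs ys : List ℕ) → length xs ≡ length ys → (∀ i → i < length xs → at xs i ≡ at ys i) → xs ≡ ys
  at-ext [] [] _ _ = refl
  at-ext (x ∷ xs) (y ∷ ys) e f = cong₂ _∷_ (f 0 (s≤s z≤n)) (at-ext xs ys (suc-injective e) (λ i p → f (suc i) (s≤s p)))

  at-++ˡ : ∀ (xs ys : List ℕ) i → i < length xs → at (xs ++ ys) i ≡ at xs i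
  at-++ˡ (x ∷ xs) ys zero _ = refl
  at-++ˡ (x ∷ xs) ys (suc i) (s≤s p) = at-++ˡ xs ys i p

  at-++ʳ : ∀ (xs ys : List ℕ) i → at (xs ++ ys) (length xs + i) ≡ at ys i
  at-++ʳ [] ys i = refl
  at-++ʳ (x ∷ xs) ys i = at-++ʳ xs ys i

  at-map : ∀ f (xs : List ℕ) i → i < length xs → at (map f xs) i ≡ f (at xs i)
  at-map f (x ∷ xs) zero _ = refl
  at-map f (x ∷ xs) (suc i) (s≤s p) = at-map f xs i p

  at-take : ∀ n (xs : List ℕ) i → i < n → at (take n xs) i ≡ at xs i
  at-take (suc n) [] i _ = refl
  at-take (suc n) (x ∷ xs) zero _ = refl
  at-take (suc n) (x ∷ xs) (suc i) (s≤s p) = at-take n xs i p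

  at-drop : ∀ n (xs : List ℕ) i → at (drop n xs) i ≡ at xs (n + i)
  at-drop zero xs i = refl
  at-drop (suc n) [] i = refl
  at-drop (suc n) (x ∷ xs) i = at-drop n xs i

  length-take≤ : ∀ n (xs : List ℕ) → n ≤ length xs → length (take n xs) ≡ n
  length-take≤ zero xs _ = refl
  length-take≤ (suc n) (x ∷ xs) (s≤s p) = cong suc (length-take≤ n xs p)

  at-map-applyUpTo : ∀ n (g h : ℕ → ℕ) w → w < n → at (map g (applyUpTo h n)) w ≡ g (h w)
  at-map-applyUpTo (suc n) g h zero _ = refl
  at-map-applyUpTo (suc n) g h (suc w) (s≤s p) = at-map-applyUpTo n g (h ∘ suc) w p

  at-map-upTo : ∀ n (g : ℕ → ℕ) w → w < n → at (map g (upTo n)) w ≡ g w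
  at-map-upTo n g w p = at-map-applyUpTo n g (λ x → x) w p

  length-map-upTo : ∀ n (g : ℕ → ℕ) → length (map g (upTo n)) ≡ n
  length-map-upTo n g = trans (length-map g (upTo n)) (length-applyUpTo (λ x → x) n)

module Polynomial where

  open import Data.Nat using (ℕ; _+_)
  open import Data.Nat.Properties using (+-assoc; +-comm)
  open import Data.List using (List; []; _∷_; _++_; map)
  open import Data.List.Properties using (map-++; ++-assoc) renaming (++-identityʳ to ++-[]-identityʳ)
  open import Data.List.Relation.Binary.Permutation.Propositional
  open import Data.List.Relation.Binary.Permutation.Propositional.Properties
    using (++⁺ˡ; ++⁺; shifts; map⁺; ++-isCommutativeMonoid)
  open import Relation.Binary.PropositionalEquality as P using (_≡_; refl; cong)
  open import Algebra.Bundles using (CommutativeSemiring)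
  open import Data.Product using (_,_)

  -- A list of exponents [a₁, …, aₖ] stands for the polynomial q^a₁ + ⋯ + q^aₖ
  -- with natural coefficients; equality of polynomials is _↭_.
  Poly : Set
  Poly = List ℕ

  infixl 6 _⊕_
  infixl 7 _⊗_

  _⊕_ : Poly → Poly → Poly
  _⊕_ = _++_

  raise : ℕ → Poly → Poly
  raise a ys = map (a +_) ys

  _⊗_ : Poly → Poly → Poly
  [] ⊗ ys = []
  (a ∷ xs) ⊗ ys = raise a ys ++ xs ⊗ ys

  𝟘 𝟙 : Poly
  𝟘 = []
  𝟙 = 0 ∷ []

  raise-0 : ∀ ys → raise 0 ys ≡ ys
  raise-0 [] = refl
  raise-0 (y ∷ ys) = cong (y ∷_) (raise-0 ys)

  raise-raise : ∀ a b ys → raise a (raise b ys) ≡ raise (a + b) ys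
  raise-raise a b [] = refl
  raise-raise a b (y ∷ ys) = P.cong₂ _∷_ (P.sym (+-assoc a b y)) (raise-raise a b ys)

  raise-++ : ∀ a xs ys → raise a (xs ++ ys) ≡ raise a xs ++ raise a ys
  raise-++ a xs ys = map-++ (a +_) xs ys

  ⊗-distribʳ : ∀ xs ys zs → (xs ++ ys) ⊗ zs ≡ xs ⊗ zs ++ ys ⊗ zs
  ⊗-distribʳ [] ys zs = refl
  ⊗-distribʳ (x ∷ xs) ys zs = P.trans (cong (raise x zs ++_) (⊗-distribʳ xs ys zs)) (P.sym (++-assoc (raise x zs) (xs ⊗ zs) (ys ⊗ zs)))

  ⊗-zeroʳ : ∀ xs → xs ⊗ [] ≡ []
  ⊗-zeroʳ [] = refl
  ⊗-zeroʳ (x ∷ xs) = ⊗-zeroʳ xs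

  raise-⊗ : ∀ a xs ys → raise a xs ⊗ ys ≡ raise a (xs ⊗ ys)
  raise-⊗ a [] ys = refl
  raise-⊗ a (x ∷ xs) ys = P.trans (P.cong₂ _++_ (P.sym (raise-raise a x ys)) (raise-⊗ a xs ys))
    (P.sym (raise-++ a (raise x ys) (xs ⊗ ys)))

  ⊗-distribˡ : ∀ xs ys zs → xs ⊗ (ys ++ zs) ↭ xs ⊗ ys ++ xs ⊗ zs
  ⊗-distribˡ [] ys zs = refl
  ⊗-distribˡ (x ∷ xs) ys zs = begin
    raise x (ys ++ zs) ++ xs ⊗ (ys ++ zs) ≡⟨ cong (_++ xs ⊗ (ys ++ zs)) (raise-++ x ys zs) ⟩
    (raise x ys ++ raise x zs) ++ xs ⊗ (ys ++ zs) ↭⟨ ++⁺ˡ (raise x ys ++ raise x zs) (⊗-distribˡ xs ys zs) ⟩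
    (raise x ys ++ raise x zs) ++ (xs ⊗ ys ++ xs ⊗ zs) ≡⟨ ++-assoc (raise x ys) (raise x zs) _ ⟩
    raise x ys ++ (raise x zs ++ (xs ⊗ ys ++ xs ⊗ zs)) ↭⟨ ++⁺ˡ (raise x ys) (shifts (raise x zs) (xs ⊗ ys)) ⟩
    raise x ys ++ (xs ⊗ ys ++ (raise x zs ++ xs ⊗ zs)) ≡⟨ P.sym (++-assoc (raise x ys) (xs ⊗ ys) _) ⟩
    (raise x ys ++ xs ⊗ ys) ++ (raise x zs ++ xs ⊗ zs) ∎
    where open PermutationReasoning

  ⊗-assoc : ∀ xs ys zs → (xs ⊗ ys) ⊗ zs ≡ xs ⊗ (ys ⊗ zs)
  ⊗-assoc [] ys zs = refl
  ⊗-assoc (x ∷ xs) ys zs = P.trans (⊗-distribʳ (raise x ys) (xs ⊗ ys) zs) (P.cong₂ _++_ (raise-⊗ x ys zs) (⊗-assoc xs ys zs))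

  ⊗-consʳ : ∀ xs a ys → xs ⊗ (a ∷ ys) ↭ map (_+ a) xs ++ xs ⊗ ys
  ⊗-consʳ [] a ys = refl
  ⊗-consʳ (x ∷ xs) a ys = begin
    (x + a) ∷ (raise x ys ++ xs ⊗ (a ∷ ys)) ↭⟨ prep (x + a) (++⁺ˡ (raise x ys) (⊗-consʳ xs a ys)) ⟩
    (x + a) ∷ (raise x ys ++ (map (_+ a) xs ++ xs ⊗ ys))
      ↭⟨ prep (x + a) (shifts (raise x ys) (map (_+ a) xs)) ⟩
    (x + a) ∷ (map (_+ a) xs ++ (raise x ys ++ xs ⊗ ys)) ∎
    where open PermutationReasoning

  map-+ʳ≡raise : ∀ a xs → map (_+ a) xs ≡ raise a xs
  map-+ʳ≡raise a [] = refl
  map-+ʳ≡raise a (x ∷ xs) = P.cong₂ _∷_ (+-comm x a) (map-+ʳ≡raise a xs)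

  ⊗-comm : ∀ xs ys → xs ⊗ ys ↭ ys ⊗ xs
  ⊗-comm [] ys = ↭-reflexive (P.sym (⊗-zeroʳ ys))
  ⊗-comm (x ∷ xs) ys = begin
    raise x ys ++ xs ⊗ ys ↭⟨ ++⁺ˡ (raise x ys) (⊗-comm xs ys) ⟩
    raise x ys ++ ys ⊗ xs ≡⟨ cong (_++ ys ⊗ xs) (P.sym (map-+ʳ≡raise x ys)) ⟩
    map (_+ x) ys ++ ys ⊗ xs ↭⟨ ↭-sym (⊗-consʳ ys x xs) ⟩
    ys ⊗ (x ∷ xs) ∎
    where open PermutationReasoning

  ⊗-congʳ : ∀ xs {ys zs} → ys ↭ zs → xs ⊗ ys ↭ xs ⊗ zs
  ⊗-congʳ [] p = refl
  ⊗-congʳ (x ∷ xs) p = ++⁺ (map⁺ (x +_) p) (⊗-congʳ xs p)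

  ⊗-congˡ : ∀ {xs ys} zs → xs ↭ ys → xs ⊗ zs ↭ ys ⊗ zs
  ⊗-congˡ zs refl = refl
  ⊗-congˡ zs (prep x p) = ++⁺ˡ (raise x zs) (⊗-congˡ zs p)
  ⊗-congˡ {x ∷ y ∷ xs} {_ ∷ _ ∷ ys} zs (swap x y p) = begin
    raise x zs ++ (raise y zs ++ xs ⊗ zs) ↭⟨ shifts (raise x zs) (raise y zs) ⟩
    raise y zs ++ (raise x zs ++ xs ⊗ zs) ↭⟨ ++⁺ˡ (raise y zs) (++⁺ˡ (raise x zs) (⊗-congˡ zs p)) ⟩
    raise y zs ++ (raise x zs ++ ys ⊗ zs) ∎
    where open PermutationReasoning
  ⊗-congˡ zs (trans p q) = trans (⊗-congˡ zs p) (⊗-congˡ zs q)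

  ⊗-cong : ∀ {xs ys zs ws} → xs ↭ ys → zs ↭ ws → xs ⊗ zs ↭ ys ⊗ ws
  ⊗-cong {ys = ys} p q = trans (⊗-congˡ _ p) (⊗-congʳ ys q)

  ⊗-identityˡ : ∀ xs → 𝟙 ⊗ xs ↭ xs
  ⊗-identityˡ xs = ↭-reflexive (P.trans (++-[]-identityʳ (raise 0 xs)) (raise-0 xs))

  ⊗-identityʳ : ∀ xs → xs ⊗ 𝟙 ↭ xs
  ⊗-identityʳ xs = trans (⊗-comm xs 𝟙) (⊗-identityˡ xs)

  polySemiring : CommutativeSemiring _ _
  polySemiring = record
    { Carrier = Poly ; _≈_ = _↭_ ; _+_ = _⊕_ ; _*_ = _⊗_ ; 0# = 𝟘 ; 1# = 𝟙
    ; isCommutativeSemiring = record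
      { isSemiring = record
        { isSemiringWithoutAnnihilatingZero = record
          { +-isCommutativeMonoid = ++-isCommutativeMonoid
          ; *-cong = ⊗-cong
          ; *-assoc = λ x y z → ↭-reflexive (⊗-assoc x y z)
          ; *-identity = ⊗-identityˡ , ⊗-identityʳ
          ; distrib = ⊗-distribˡ , λ z x y → ↭-reflexive (⊗-distribʳ x y z)
          }
        ; zero = (λ _ → refl) , (λ x → ↭-reflexive (⊗-zeroʳ x))
        }
      ; *-comm = ⊗-comm
      }
    }

  q^ : ℕ → Poly
  q^ a = a ∷ []

module SymmetricFunctions where

  open import Data.Nat using (ℕ; zero; suc; _+_)
  open import Data.List using (List; []; _∷_; _++_; map; take; drop; length)
  open import Data.List.Relation.Binary.Permutation.Propositional
  open import Data.List.Relation.Binary.Permutation.Propositional.Properties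
    using (++⁺ˡ; ++⁺; ++-comm)
  open import Relation.Binary.PropositionalEquality as P using (refl)
  open import Function using (_∘_)
  open import Defs using (at)
  open Polynomial
  open import Algebra.Solver.Ring.NaturalCoefficients.Default polySemiring

  ⨁ : ∀ {A : Set} → ℕ → (ℕ → List A) → List A
  ⨁ zero f = []
  ⨁ (suc m) f = f 0 ++ ⨁ m (f ∘ suc)

  ⨁-cong : ∀ m {f g : ℕ → Poly} → (∀ p → f p ↭ g p) → ⨁ m f ↭ ⨁ m g
  ⨁-cong zero e = refl
  ⨁-cong (suc m) e = ++⁺ (e 0) (⨁-cong m (e ∘ suc))

  ⨁-⊕ : ∀ m (f g : ℕ → Poly) → ⨁ m (λ p → f p ⊕ g p) ↭ ⨁ m f ⊕ ⨁ m g
  ⨁-⊕ zero f g = refl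
  ⨁-⊕ (suc m) f g = begin
    (f 0 ++ g 0) ++ ⨁ m (λ p → f (suc p) ⊕ g (suc p)) ↭⟨ ++⁺ˡ (f 0 ++ g 0) (⨁-⊕ m (f ∘ suc) (g ∘ suc)) ⟩
    (f 0 ++ g 0) ++ (⨁ m (f ∘ suc) ++ ⨁ m (g ∘ suc))
      ↭⟨ solve 4 (λ a b c d → (a :+ b) :+ (c :+ d) := (a :+ c) :+ (b :+ d)) refl (f 0) (g 0) (⨁ m (f ∘ suc)) (⨁ m (g ∘ suc)) ⟩
    (f 0 ++ ⨁ m (f ∘ suc)) ++ (g 0 ++ ⨁ m (g ∘ suc)) ∎
    where open PermutationReasoning

  ⨁-⊗ : ∀ m c (f : ℕ → Poly) → ⨁ m (λ p → c ⊗ f p) ↭ c ⊗ ⨁ m f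
  ⨁-⊗ zero c f = ↭-reflexive (P.sym (⊗-zeroʳ c))
  ⨁-⊗ (suc m) c f = trans (++⁺ˡ (c ⊗ f 0) (⨁-⊗ m c (f ∘ suc))) (↭-sym (⊗-distribˡ c (f 0) (⨁ m (f ∘ suc))))

  -- complete k s is the complete homogeneous symmetric polynomial h_k in the
  -- variables q^a, a ∈ s.
  complete : ℕ → List ℕ → Poly
  complete zero s = 𝟙
  complete (suc k) [] = 𝟘
  complete (suc k) (a ∷ s) = complete (suc k) s ⊕ q^ a ⊗ complete k (a ∷ s)

  complete-swap : ∀ k a b s → complete k (a ∷ b ∷ s) ↭ complete k (b ∷ a ∷ s)
  complete-swap zero a b s = refl
  complete-swap (suc zero) a b s = solve 3 (λ h x y → (h :+ y :* con 1) :+ x :* con 1 := (h :+ x :* con 1) :+ y :* con 1)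
                                     refl (complete 1 s) (q^ a) (q^ b)
  complete-swap (suc (suc k)) a b s = begin
    (complete K2 s ⊕ q^ b ⊗ complete K (b ∷ s)) ⊕ q^ a ⊗ complete K (a ∷ b ∷ s)
      ↭⟨ ++⁺ˡ (complete K2 s ⊕ q^ b ⊗ complete K (b ∷ s)) (⊗-congʳ (q^ a) (complete-swap (suc k) a b s)) ⟩
    (complete K2 s ⊕ q^ b ⊗ complete K (b ∷ s)) ⊕ q^ a ⊗ (complete K (a ∷ s) ⊕ q^ b ⊗ complete k (b ∷ a ∷ s))
      ↭⟨ solve 6 (λ h B A X Y W → (h :+ B :* Y) :+ A :* (X :+ B :* W) := (h :+ A :* X) :+ B :* (Y :+ A :* W))
           refl (complete K2 s) (q^ b) (q^ a) (complete K (a ∷ s)) (complete K (b ∷ s)) (complete k (b ∷ a ∷ s)) ⟩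
    (complete K2 s ⊕ q^ a ⊗ complete K (a ∷ s)) ⊕ q^ b ⊗ (complete K (b ∷ s) ⊕ q^ a ⊗ complete k (b ∷ a ∷ s))
      ↭⟨ ++⁺ˡ (complete K2 s ⊕ q^ a ⊗ complete K (a ∷ s))
          (⊗-congʳ (q^ b) (++⁺ˡ (complete K (b ∷ s)) (⊗-congʳ (q^ a) (complete-swap k b a s)))) ⟩
    (complete K2 s ⊕ q^ a ⊗ complete K (a ∷ s)) ⊕ q^ b ⊗ (complete K (b ∷ s) ⊕ q^ a ⊗ complete k (a ∷ b ∷ s))
      ↭⟨ ++⁺ˡ (complete K2 s ⊕ q^ a ⊗ complete K (a ∷ s)) (⊗-congʳ (q^ b) (complete-swap (suc k) a b s)) ⟩
    (complete K2 s ⊕ q^ a ⊗ complete K (a ∷ s)) ⊕ q^ b ⊗ complete K (b ∷ a ∷ s) ∎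
    where open PermutationReasoning
          K = suc k
          K2 = suc (suc k)

  private
    complete-cons-cong : ∀ {s s'} → (∀ k → complete k s ↭ complete k s') → ∀ x k → complete k (x ∷ s) ↭ complete k (x ∷ s')
    complete-cons-cong e x zero = refl
    complete-cons-cong e x (suc k) = ++⁺ (e (suc k)) (⊗-congʳ (q^ x) (complete-cons-cong e x k))

  complete-↭ : ∀ {s s'} → s ↭ s' → ∀ k → complete k s ↭ complete k s'
  complete-↭ refl k = refl
  complete-↭ (prep x p) = complete-cons-cong (complete-↭ p) x
  complete-↭ (swap x y p) k = trans (complete-cons-cong (complete-cons-cong (complete-↭ p) y) x k) (complete-swap k x y _)
  complete-↭ (trans p q) k = trans (complete-↭ p k) (complete-↭ q k)

  raisedPrefix : List ℕ → ℕ → List ℕ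
  raisedPrefix s p = map suc (take (suc p) s) ++ drop p s

  heightStep : List ℕ → ℕ → List ℕ
  heightStep s p = 0 ∷ raisedPrefix s p

  insertionSum : ℕ → List ℕ → Poly
  insertionSum k s = ⨁ (length s) (λ p → q^ (at s p) ⊗ complete k (raisedPrefix s p))

  insertionSumWith : ℕ → ℕ → List ℕ → Poly
  insertionSumWith k x s = ⨁ (length s) (λ p → q^ (at s p) ⊗ complete k (x ∷ raisedPrefix s p))

  qInt : ℕ → Poly
  qInt zero = []
  qInt (suc j) = 𝟙 ⊕ q^ 1 ⊗ qInt j

  insertionSumWith-suc : ∀ k x s → insertionSumWith (suc k) x s ↭ insertionSum (suc k) s ⊕ q^ x ⊗ insertionSumWith k x s
  insertionSumWith-suc k x s = begin
    insertionSumWith (suc k) x s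
      ↭⟨ ⨁-cong (length s) (λ p → solve 4 (λ c A X B → c :* (A :+ X :* B) := c :* A :+ X :* (c :* B))
                                    refl (q^ (at s p)) (complete (suc k) (raisedPrefix s p)) (q^ x) (complete k (x ∷ raisedPrefix s p))) ⟩
    ⨁ (length s) (λ p → q^ (at s p) ⊗ complete (suc k) (raisedPrefix s p) ⊕ q^ x ⊗ (q^ (at s p) ⊗ complete k (x ∷ raisedPrefix s p)))
      ↭⟨ ⨁-⊕ (length s) _ _ ⟩
    insertionSum (suc k) s ⊕ ⨁ (length s) (λ p → q^ x ⊗ (q^ (at s p) ⊗ complete k (x ∷ raisedPrefix s p)))
      ↭⟨ ++⁺ˡ (insertionSum (suc k) s) (⨁-⊗ (length s) (q^ x) _) ⟩
    insertionSum (suc k) s ⊕ q^ x ⊗ insertionSumWith k x s ∎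
    where open PermutationReasoning

  insertion-identity-cons : ∀ a s → (∀ k → insertionSum k s ↭ qInt (suc k) ⊗ complete (suc k) s) → ∀ k →
        q^ a ⊗ complete k (suc a ∷ a ∷ s) ⊕ insertionSumWith k (suc a) s ↭ qInt (suc k) ⊗ complete (suc k) (a ∷ s)
  insertion-identity-cons a s IH zero = begin
    q^ a ⊗ 𝟙 ⊕ insertionSum 0 s ↭⟨ ++⁺ˡ (q^ a ⊗ 𝟙) (IH 0) ⟩
    q^ a ⊗ 𝟙 ⊕ qInt 1 ⊗ complete 1 s
      ↭⟨ solve 2 (λ A Y → A :* con 1 :+ con 1 :* Y := con 1 :* (Y :+ A :* con 1)) refl (q^ a) (complete 1 s) ⟩
    qInt 1 ⊗ (complete 1 s ⊕ q^ a ⊗ 𝟙) ∎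
    where open PermutationReasoning
  insertion-identity-cons a s IH (suc k) = begin
    q^ a ⊗ (X ⊕ q^ (suc a) ⊗ W) ⊕ insertionSumWith (suc k) (suc a) s
      ↭⟨ ++⁺ˡ (q^ a ⊗ (X ⊕ q^ (suc a) ⊗ W)) (insertionSumWith-suc k (suc a) s) ⟩
    q^ a ⊗ (X ⊕ q^ (suc a) ⊗ W) ⊕ (insertionSum (suc k) s ⊕ q^ (suc a) ⊗ insertionSumWith k (suc a) s)
      ↭⟨ solve 6 (λ A X B W U' V' → A :* (X :+ B :* W) :+ (U' :+ B :* V') := A :* X :+ U' :+ B :* (A :* W :+ V'))
           refl (q^ a) X (q^ (suc a)) W (insertionSum (suc k) s) (insertionSumWith k (suc a) s) ⟩
    q^ a ⊗ X ⊕ insertionSum (suc k) s ⊕ q^ (suc a) ⊗ (q^ a ⊗ W ⊕ insertionSumWith k (suc a) s)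
      ↭⟨ ++⁺ (++⁺ˡ (q^ a ⊗ X) (IH (suc k))) (⊗-congʳ (q^ (suc a)) (insertion-identity-cons a s IH k)) ⟩
    q^ a ⊗ X ⊕ qInt (suc (suc k)) ⊗ complete (suc (suc k)) s ⊕ q^ 1 ⊗ q^ a ⊗ (qInt (suc k) ⊗ X)
      ↭⟨ solve 5 (λ A X Y O Qk → A :* X :+ (con 1 :+ O :* Qk) :* Y :+ O :* A :* (Qk :* X) := (con 1 :+ O :* Qk) :* (Y :+ A :* X))
           refl (q^ a) X (complete (suc (suc k)) s) (q^ 1) (qInt (suc k)) ⟩
    qInt (suc (suc k)) ⊗ (complete (suc (suc k)) s ⊕ q^ a ⊗ X) ∎
    where open PermutationReasoning
          X = complete (suc k) (a ∷ s)
          W = complete k (suc a ∷ a ∷ s)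

  insertion-identity : ∀ s k → insertionSum k s ↭ qInt (suc k) ⊗ complete (suc k) s
  insertion-identity [] k = ↭-reflexive (P.sym (⊗-zeroʳ (qInt (suc k))))
  insertion-identity (a ∷ s) k = insertion-identity-cons a s (insertion-identity s) k

  -- q^(cr L) ⊗ Ψ l 0 (heights L) lists the crossing numbers of the level-l
  -- descendants of L.  The index k generalises this so that Ψ-suc-zero and
  -- Ψ-suc-suc reduce Ψ to the symmetric polynomials complete.
  Ψ : ℕ → ℕ → List ℕ → Poly
  Ψ zero k s = complete k s
  Ψ (suc l) k s = ⨁ (length s) (λ p → q^ (at s p) ⊗ Ψ l k (heightStep s p))

  Ψ-suc-zero : ∀ l s → Ψ (suc l) 0 s ↭ qInt 1 ⊗ Ψ l 1 s
  Ψ-suc-suc : ∀ l k s → Ψ (suc l) (suc k) s ↭ Ψ (suc l) k s ⊕ qInt (suc (suc k)) ⊗ Ψ l (suc (suc k)) s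
  Ψ-suc-zero zero s = insertion-identity s 0
  Ψ-suc-zero (suc l) s = begin
    ⨁ (length s) (λ p → q^ (at s p) ⊗ Ψ (suc l) 0 (heightStep s p))
      ↭⟨ ⨁-cong (length s) (λ p → ⊗-congʳ (q^ (at s p)) (Ψ-suc-zero l (heightStep s p))) ⟩
    ⨁ (length s) (λ p → q^ (at s p) ⊗ (qInt 1 ⊗ Ψ l 1 (heightStep s p)))
      ↭⟨ ⨁-cong (length s) (λ p → solve 3 (λ c A B → c :* (A :* B) := A :* (c :* B))
                                    refl (q^ (at s p)) (qInt 1) (Ψ l 1 (heightStep s p))) ⟩
    ⨁ (length s) (λ p → qInt 1 ⊗ (q^ (at s p) ⊗ Ψ l 1 (heightStep s p))) ↭⟨ ⨁-⊗ (length s) (qInt 1) _ ⟩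
    qInt 1 ⊗ Ψ (suc l) 1 s ∎
    where open PermutationReasoning
  Ψ-suc-suc zero k s = begin
    ⨁ (length s) (λ p → q^ (at s p) ⊗ (complete (suc k) (raisedPrefix s p) ⊕ q^ 0 ⊗ complete k (heightStep s p)))
      ↭⟨ ⨁-cong (length s) (λ p → solve 3 (λ c A B → c :* (A :+ con 1 :* B) := c :* A :+ c :* B)
                                    refl (q^ (at s p)) (complete (suc k) (raisedPrefix s p)) (complete k (heightStep s p))) ⟩
    ⨁ (length s) (λ p → q^ (at s p) ⊗ complete (suc k) (raisedPrefix s p) ⊕ q^ (at s p) ⊗ complete k (heightStep s p))
      ↭⟨ ⨁-⊕ (length s) _ _ ⟩
    insertionSum (suc k) s ⊕ Ψ 1 k s ↭⟨ ++-comm (insertionSum (suc k) s) (Ψ 1 k s) ⟩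
    Ψ 1 k s ⊕ insertionSum (suc k) s ↭⟨ ++⁺ˡ (Ψ 1 k s) (insertion-identity s (suc k)) ⟩
    Ψ 1 k s ⊕ qInt (suc (suc k)) ⊗ complete (suc (suc k)) s ∎
    where open PermutationReasoning
  Ψ-suc-suc (suc l) k s = begin
    ⨁ (length s) (λ p → q^ (at s p) ⊗ Ψ (suc l) (suc k) (heightStep s p))
      ↭⟨ ⨁-cong (length s) (λ p → ⊗-congʳ (q^ (at s p)) (Ψ-suc-suc l k (heightStep s p))) ⟩
    ⨁ (length s) (λ p → q^ (at s p) ⊗ (Ψ (suc l) k (heightStep s p) ⊕ Qk ⊗ Ψ l (suc (suc k)) (heightStep s p)))
      ↭⟨ ⨁-cong (length s) (λ p → solve 4 (λ c A Z B → c :* (A :+ Z :* B) := c :* A :+ Z :* (c :* B))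
                                    refl (q^ (at s p)) (Ψ (suc l) k (heightStep s p)) Qk (Ψ l (suc (suc k)) (heightStep s p))) ⟩
    ⨁ (length s) (λ p → q^ (at s p) ⊗ Ψ (suc l) k (heightStep s p) ⊕ Qk ⊗ (q^ (at s p) ⊗ Ψ l (suc (suc k)) (heightStep s p)))
      ↭⟨ ⨁-⊕ (length s) _ _ ⟩
    Ψ (suc (suc l)) k s ⊕ ⨁ (length s) (λ p → Qk ⊗ (q^ (at s p) ⊗ Ψ l (suc (suc k)) (heightStep s p)))
      ↭⟨ ++⁺ˡ (Ψ (suc (suc l)) k s) (⨁-⊗ (length s) Qk _) ⟩
    Ψ (suc (suc l)) k s ⊕ Qk ⊗ Ψ (suc l) (suc (suc k)) s ∎
    where open PermutationReasoning
          Qk = qInt (suc (suc k))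

  Ψ-↭ : ∀ l k {s s'} → s ↭ s' → Ψ l k s ↭ Ψ l k s'
  Ψ-↭ zero k p = complete-↭ p k
  Ψ-↭ (suc l) zero {s} {s'} p = trans (Ψ-suc-zero l s) (trans (⊗-congʳ (qInt 1) (Ψ-↭ l 1 p)) (↭-sym (Ψ-suc-zero l s')))
  Ψ-↭ (suc l) (suc k) {s} {s'} p = trans (Ψ-suc-suc l k s)
      (trans (++⁺ (Ψ-↭ (suc l) k p) (⊗-congʳ (qInt (suc (suc k))) (Ψ-↭ l (suc (suc k)) p))) (↭-sym (Ψ-suc-suc l k s')))

module Children where

  open import Data.Nat using (ℕ; zero; suc; _+_; _∸_; _<_; _≤_; z≤n; s≤s; _<ᵇ_; _≡ᵇ_; _<?_)
  open import Data.Nat.Properties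
  open import Data.Bool using (Bool; false; _∧_; not; if_then_else_)
  open import Data.Bool.Properties using (∧-zeroʳ)
  open import Data.List using (List; _∷_; _++_; map; take; drop; length; upTo)
  open import Data.List.Properties using (length-map; length-++; length-drop)
  open import Relation.Binary.PropositionalEquality as P using (_≡_; refl; cong; cong₂; sym; trans; module ≡-Reasoning)
  open import Relation.Nullary using (yes; no)
  open import Function using (_∘_)
  open import Data.Empty using (⊥-elim)
  open import Defs using (at; child; cr; ne; shift; unshift)
  open BoolArith
  open Relabelling
  open FiniteSums
  open ListLookup
  open SymmetricFunctions using (heightStep; raisedPrefix)

  crosses : List ℕ → ℕ → ℕ → Bool
  crosses L i j = (i <ᵇ j) ∧ (j <ᵇ at L i) ∧ (at L i <ᵇ at L j)

  nests : List ℕ → ℕ → ℕ → Bool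
  nests L i j = (i <ᵇ j) ∧ (j <ᵇ at L j) ∧ (at L j <ᵇ at L i)

  pairCount : (ℕ → ℕ → Bool) → ℕ → ℕ
  pairCount P m = ∑ m (λ i → ∑ m (λ j → iverson (P i j)))

  cr≡pairCount : ∀ L → cr L ≡ pairCount (crosses L) (length L)
  cr≡pairCount L = trans (sum-map-upTo (length L) _) (∑-cong (length L) (λ i _ → sum-map-upTo (length L) _))

  ne≡pairCount : ∀ L → ne L ≡ pairCount (nests L) (length L)
  ne≡pairCount L = trans (sum-map-upTo (length L) _) (∑-cong (length L) (λ i _ → sum-map-upTo (length L) _))

  -- height L p counts the arcs {j, L j} with j < p ≤ L j, i.e. those passing
  -- over the gap just before vertex p.
  height : List ℕ → ℕ → ℕ
  height L p = ∑ (length L) (λ j → iverson ((j <ᵇ p) ∧ not (at L j <ᵇ p)))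

  closedBefore : List ℕ → ℕ → ℕ
  closedBefore L p = ∑ (length L) (λ j → iverson ((j <ᵇ at L j) ∧ (at L j <ᵇ p)))

  heights : List ℕ → List ℕ
  heights L = map (height L) (upTo (suc (length L)))

  closedProfile : List ℕ → List ℕ
  closedProfile L = map (closedBefore L) (upTo (suc (length L)))

  length-heights : ∀ L → length (heights L) ≡ suc (length L)
  length-heights L = length-map-upTo (suc (length L)) (height L)

  length-closedProfile : ∀ L → length (closedProfile L) ≡ suc (length L)
  length-closedProfile L = length-map-upTo (suc (length L)) (closedBefore L)

  closedStep : List ℕ → ℕ → List ℕ
  closedStep s p = 0 ∷ take (suc p) s ++ map suc (drop p s)

  module StepEntries (s : List ℕ) (k : ℕ) (k< : suc k ≤ length s) where

    private
      length-take : length (take (suc k) s) ≡ suc k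
      length-take = length-take≤ (suc k) s k<
      length-map-take : length (map suc (take (suc k) s)) ≡ suc k
      length-map-take = trans (length-map suc (take (suc k) s)) length-take
      1+k+[w∸k] : ∀ w → k ≤ w → suc k + (w ∸ k) ≡ suc w
      1+k+[w∸k] w k≤w = cong suc (m+[n∸m]≡n k≤w)
      length-drop+1+k : suc k + length (drop k s) ≡ suc (length s)
      length-drop+1+k = cong suc (trans (cong (k +_) (length-drop k s)) (m+[n∸m]≡n (≤-trans (n≤1+n k) k<)))

    heightStep-at-low : ∀ w → w ≤ k → at (heightStep s k) (suc w) ≡ suc (at s w)
    heightStep-at-low w w≤k = begin
      at (map suc (take (suc k) s) ++ drop k s) w
        ≡⟨ at-++ˡ (map suc (take (suc k) s)) (drop k s) w (P.subst (w <_) (sym length-map-take) (s≤s w≤k)) ⟩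
      at (map suc (take (suc k) s)) w
        ≡⟨ at-map suc (take (suc k) s) w (P.subst (w <_) (sym length-take) (s≤s w≤k)) ⟩
      suc (at (take (suc k) s) w)
        ≡⟨ cong suc (at-take (suc k) s w (s≤s w≤k)) ⟩
      suc (at s w) ∎
      where open ≡-Reasoning

    heightStep-at-high : ∀ w → k ≤ w → at (heightStep s k) (suc (suc w)) ≡ at s w
    heightStep-at-high w k≤w = begin
      at (raisedPrefix s k) (suc w)
        ≡⟨ cong (at (raisedPrefix s k)) (trans (sym (1+k+[w∸k] w k≤w)) (cong (_+ (w ∸ k)) (sym length-map-take))) ⟩
      at (raisedPrefix s k) (length (map suc (take (suc k) s)) + (w ∸ k))
        ≡⟨ at-++ʳ (map suc (take (suc k) s)) (drop k s) (w ∸ k) ⟩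
      at (drop k s) (w ∸ k)
        ≡⟨ trans (at-drop k s (w ∸ k)) (cong (at s) (m+[n∸m]≡n k≤w)) ⟩
      at s w ∎
      where open ≡-Reasoning

    length-heightStep : length (heightStep s k) ≡ suc (suc (length s))
    length-heightStep = cong suc (trans (length-++ (map suc (take (suc k) s)))
      (trans (cong (_+ length (drop k s)) length-map-take) length-drop+1+k))

    closedStep-at-low : ∀ w → w ≤ k → at (closedStep s k) (suc w) ≡ at s w
    closedStep-at-low w w≤k =
      trans (at-++ˡ (take (suc k) s) (map suc (drop k s)) w (P.subst (w <_) (sym length-take) (s≤s w≤k)))
            (at-take (suc k) s w (s≤s w≤k))

    closedStep-at-high : ∀ w → k ≤ w → w < length s → at (closedStep s k) (suc (suc w)) ≡ suc (at s w)
    closedStep-at-high w k≤w w< = begin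
      at (take (suc k) s ++ map suc (drop k s)) (suc w)
        ≡⟨ cong (at (take (suc k) s ++ map suc (drop k s))) (trans (sym (1+k+[w∸k] w k≤w)) (cong (_+ (w ∸ k)) (sym length-take))) ⟩
      at (take (suc k) s ++ map suc (drop k s)) (length (take (suc k) s) + (w ∸ k))
        ≡⟨ at-++ʳ (take (suc k) s) (map suc (drop k s)) (w ∸ k) ⟩
      at (map suc (drop k s)) (w ∸ k)
        ≡⟨ at-map suc (drop k s) (w ∸ k) (P.subst (w ∸ k <_) (sym (length-drop k s)) (∸-monoˡ-< w< k≤w)) ⟩
      suc (at (drop k s) (w ∸ k))
        ≡⟨ cong suc (trans (at-drop k s (w ∸ k)) (cong (at s) (m+[n∸m]≡n k≤w))) ⟩
      suc (at s w) ∎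
      where open ≡-Reasoning

    length-closedStep : length (closedStep s k) ≡ suc (suc (length s))
    length-closedStep = cong suc (trans (length-++ (take (suc k) s))
      (trans (cong₂ _+_ length-take (length-map suc (drop k s))) length-drop+1+k))

  map-upTo-ext : ∀ n (f : ℕ → ℕ) ys → length ys ≡ n → (∀ i → i < n → f i ≡ at ys i) → map f (upTo n) ≡ ys
  map-upTo-ext n f ys len≡ e = at-ext (map f (upTo n)) ys (trans (length-map-upTo n f) (sym len≡))
    (λ i i< → let i<n = P.subst (i <_) (length-map-upTo n f) i< in trans (at-map-upTo n f i i<n) (e i i<n))

  module ChildOf (L : List ℕ) (k : ℕ) (k≤ : k ≤ length L) where

    len = length L
    x = suc k
    C = child L x

    private
      entry : ℕ → ℕ
      entry w = if w ≡ᵇ 0 then x else (if w ≡ᵇ x then 0 else shift x (at L (unshift x w)))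

    length-child : length C ≡ suc (suc len)
    length-child = length-map-upTo (suc (suc len)) entry

    child-at-x : at C x ≡ 0
    child-at-x = trans (at-map-upTo (suc (suc len)) entry x (s≤s (s≤s k≤))) e
      where
      e : entry x ≡ 0
      e rewrite ≡ᵇ-refl k = refl

    child-at-shift : ∀ v → v < len → at C (shift x v) ≡ shift x (at L v)
    child-at-shift v v<len = trans (at-map-upTo (suc (suc len)) entry (shift x v) (shift<2+len k len v v<len)) e
      where
      e : entry (shift x v) ≡ shift x (at L v)
      e with shiftCase k v
      ... | below p eq rewrite eq | ≢⇒≡ᵇ-false (<⇒≢ p) | <ᵇ-true p = refl
      ... | above p eq rewrite eq | ≢⇒≡ᵇ-false (>⇒≢ (s≤s p)) | <ᵇ-false (m≤n⇒m≤1+n p) = refl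

    ∑-child : ∀ f → ∑ (length C) f ≡ f 0 + f x + ∑ len (f ∘ shift x)
    ∑-child f = trans (cong (λ m → ∑ m f) length-child) (∑-remove-two len k k≤ f)

    pairCount-child : ∀ P Q → (∀ i → P i 0 ≡ false) → (∀ j → P x j ≡ false) →
      (∀ v → v < len → P (shift x v) x ≡ false) →
      (∀ v w → v < len → w < len → P (shift x v) (shift x w) ≡ Q v w) →
      pairCount P (length C) ≡ ∑ (length C) (λ j → iverson (P 0 j)) + pairCount Q len
    pairCount-child P Q P-0 P-x P-shift-x P-shift = begin
      pairCount P (length C)                  ≡⟨ ∑-child row ⟩
      row 0 + row x + ∑ len (row ∘ shift x)   ≡⟨ cong₂ (λ a b → row 0 + a + b) row-x row-shift ⟩
      row 0 + 0 + pairCount Q len             ≡⟨ cong (_+ pairCount Q len) (+-identityʳ (row 0)) ⟩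
      row 0 + pairCount Q len                 ∎
      where
      open ≡-Reasoning
      row : ℕ → ℕ
      row i = ∑ (length C) (λ j → iverson (P i j))
      row-x : row x ≡ 0
      row-x = ∑-zero (length C) (λ j _ → cong iverson (P-x j))
      row-shift : ∑ len (row ∘ shift x) ≡ pairCount Q len
      row-shift = ∑-cong len λ v v< → begin
        row (shift x v)
          ≡⟨ ∑-child (λ j → iverson (P (shift x v) j)) ⟩
        iverson (P (shift x v) 0) + iverson (P (shift x v) x) + ∑ len (λ w → iverson (P (shift x v) (shift x w)))
          ≡⟨ cong₂ (λ a b → iverson a + iverson b + ∑ len (λ w → iverson (P (shift x v) (shift x w))))
              (P-0 (shift x v)) (P-shift-x v v<) ⟩
        ∑ len (λ w → iverson (P (shift x v) (shift x w)))
          ≡⟨ ∑-cong len (λ w w< → cong iverson (P-shift v w v< w<)) ⟩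
        ∑ len (λ w → iverson (Q v w)) ∎

    cr-child : cr C ≡ height L k + cr L
    cr-child = begin
      cr C                                                       ≡⟨ cr≡pairCount C ⟩
      pairCount (crosses C) (length C)
        ≡⟨ pairCount-child (crosses C) (crosses L) (λ _ → refl) cr-x cr-shift-x cr-shift ⟩
      ∑ (length C) (λ j → iverson (crosses C 0 j)) + pairCount (crosses L) len
        ≡⟨ cong₂ _+_ row-0 (sym (cr≡pairCount L)) ⟩
      height L k + cr L                                          ∎
      where
      open ≡-Reasoning
      cr-x : ∀ j → crosses C x j ≡ false
      cr-x j rewrite child-at-x = ∧-zeroʳ (x <ᵇ j)
      cr-shift-x : ∀ v → v < len → crosses C (shift x v) x ≡ false
      cr-shift-x v v< rewrite child-at-x = trans (cong ((shift x v <ᵇ x) ∧_) (∧-zeroʳ _)) (∧-zeroʳ _)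
      cr-shift : ∀ v w → v < len → w < len → crosses C (shift x v) (shift x w) ≡ crosses L v w
      cr-shift v w v< w< rewrite child-at-shift v v< | child-at-shift w w<
        | shift-<ᵇ k v w | shift-<ᵇ k w (at L v) | shift-<ᵇ k (at L v) (at L w) = refl
      cr-0x : crosses C 0 x ≡ false
      cr-0x rewrite <ᵇ-false {k} {k} ≤-refl = refl
      cr-0-shift : ∀ w → w < len → crosses C 0 (shift x w) ≡ ((w <ᵇ k) ∧ not (at L w <ᵇ k))
      cr-0-shift w w< rewrite 0<ᵇshift k w | shift<ᵇ1+k k w | child-at-shift w w< | 1+k<ᵇshift k (at L w) = refl
      row-0 : ∑ (length C) (λ j → iverson (crosses C 0 j)) ≡ height L k
      row-0 = trans (∑-child (λ j → iverson (crosses C 0 j)))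
          (trans (cong (λ b → iverson b + ∑ len (λ w → iverson (crosses C 0 (shift x w)))) cr-0x)
                (∑-cong len (λ w w< → cong iverson (cr-0-shift w w<))))

    ne-child : ne C ≡ closedBefore L k + ne L
    ne-child = begin
      ne C                                                     ≡⟨ ne≡pairCount C ⟩
      pairCount (nests C) (length C)
        ≡⟨ pairCount-child (nests C) (nests L) (λ _ → refl) ne-x ne-shift-x ne-shift ⟩
      ∑ (length C) (λ j → iverson (nests C 0 j)) + pairCount (nests L) len
        ≡⟨ cong₂ _+_ row-0 (sym (ne≡pairCount L)) ⟩
      closedBefore L k + ne L                                  ∎
      where
      open ≡-Reasoning
      ne-x : ∀ j → nests C x j ≡ false
      ne-x j rewrite child-at-x = trans (cong ((x <ᵇ j) ∧_) (∧-zeroʳ _)) (∧-zeroʳ _)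
      ne-shift-x : ∀ v → v < len → nests C (shift x v) x ≡ false
      ne-shift-x v v< rewrite child-at-x = ∧-zeroʳ _
      ne-shift : ∀ v w → v < len → w < len → nests C (shift x v) (shift x w) ≡ nests L v w
      ne-shift v w v< w< rewrite child-at-shift v v< | child-at-shift w w<
        | shift-<ᵇ k v w | shift-<ᵇ k w (at L w) | shift-<ᵇ k (at L w) (at L v) = refl
      ne-0x : nests C 0 x ≡ false
      ne-0x rewrite child-at-x = refl
      ne-0-shift : ∀ w → w < len → nests C 0 (shift x w) ≡ ((w <ᵇ at L w) ∧ (at L w <ᵇ k))
      ne-0-shift w w< rewrite 0<ᵇshift k w | child-at-shift w w< | shift-<ᵇ k w (at L w) | shift<ᵇ1+k k (at L w) = refl
      row-0 : ∑ (length C) (λ j → iverson (nests C 0 j)) ≡ closedBefore L k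
      row-0 = trans (∑-child (λ j → iverson (nests C 0 j)))
          (trans (cong (λ b → iverson b + ∑ len (λ w → iverson (nests C 0 (shift x w)))) ne-0x)
                (∑-cong len (λ w w< → cong iverson (ne-0-shift w w<))))

    height-child-0 : height C 0 ≡ 0
    height-child-0 = ∑-zero (length C) (λ _ _ → refl)

    height-child-low : ∀ w → w ≤ k → height C (suc w) ≡ suc (height L w)
    height-child-low w w≤k = trans (∑-child (λ j → iverson ((j <ᵇ suc w) ∧ not (at C j <ᵇ suc w))))
        (cong₂ _+_ new-arcs (∑-cong len old-arcs))
      where
      new-arcs : iverson (not (x <ᵇ suc w)) + iverson ((x <ᵇ suc w) ∧ not (at C x <ᵇ suc w)) ≡ 1
      new-arcs rewrite <ᵇ-false {k} {w} w≤k = refl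
      old-arcs : ∀ v → v < len → iverson ((shift x v <ᵇ suc w) ∧ not (at C (shift x v) <ᵇ suc w))
                                 ≡ iverson ((v <ᵇ w) ∧ not (at L v <ᵇ w))
      old-arcs v v< rewrite child-at-shift v v< | shift<ᵇ-low k v w w≤k | shift<ᵇ-low k (at L v) w w≤k = refl

    height-child-high : ∀ w → k ≤ w → height C (suc (suc w)) ≡ height L w
    height-child-high w k≤w = trans (∑-child (λ j → iverson ((j <ᵇ suc (suc w)) ∧ not (at C j <ᵇ suc (suc w)))))
        (cong₂ _+_ new-arcs (∑-cong len old-arcs))
      where
      new-arcs : iverson (not (x <ᵇ suc (suc w))) + iverson ((x <ᵇ suc (suc w)) ∧ not (at C x <ᵇ suc (suc w))) ≡ 0
      new-arcs rewrite <ᵇ-true {k} {suc w} (s≤s k≤w) | child-at-x = refl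
      old-arcs : ∀ v → v < len → iverson ((shift x v <ᵇ suc (suc w)) ∧ not (at C (shift x v) <ᵇ suc (suc w)))
                                 ≡ iverson ((v <ᵇ w) ∧ not (at L v <ᵇ w))
      old-arcs v v< rewrite child-at-shift v v< | shift<ᵇ-high k v w k≤w | shift<ᵇ-high k (at L v) w k≤w = refl

    closedBefore-child-0 : closedBefore C 0 ≡ 0
    closedBefore-child-0 = ∑-zero (length C) (λ j _ → cong iverson (∧-zeroʳ (j <ᵇ at C j)))

    closedBefore-child-low : ∀ w → w ≤ k → closedBefore C (suc w) ≡ closedBefore L w
    closedBefore-child-low w w≤k = trans (∑-child (λ j → iverson ((j <ᵇ at C j) ∧ (at C j <ᵇ suc w))))
        (cong₂ _+_ new-arcs (∑-cong len old-arcs))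
      where
      new-arcs : iverson (x <ᵇ suc w) + iverson ((x <ᵇ at C x) ∧ (at C x <ᵇ suc w)) ≡ 0
      new-arcs rewrite <ᵇ-false {k} {w} w≤k | child-at-x = refl
      old-arcs : ∀ v → v < len → iverson ((shift x v <ᵇ at C (shift x v)) ∧ (at C (shift x v) <ᵇ suc w))
                                 ≡ iverson ((v <ᵇ at L v) ∧ (at L v <ᵇ w))
      old-arcs v v< rewrite child-at-shift v v< | shift-<ᵇ k v (at L v) | shift<ᵇ-low k (at L v) w w≤k = refl

    closedBefore-child-high : ∀ w → k ≤ w → closedBefore C (suc (suc w)) ≡ suc (closedBefore L w)
    closedBefore-child-high w k≤w = trans (∑-child (λ j → iverson ((j <ᵇ at C j) ∧ (at C j <ᵇ suc (suc w)))))
        (cong₂ _+_ new-arcs (∑-cong len old-arcs))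
      where
      new-arcs : iverson (x <ᵇ suc (suc w)) + iverson ((x <ᵇ at C x) ∧ (at C x <ᵇ suc (suc w))) ≡ 1
      new-arcs rewrite <ᵇ-true {k} {suc w} (s≤s k≤w) | child-at-x = refl
      old-arcs : ∀ v → v < len → iverson ((shift x v <ᵇ at C (shift x v)) ∧ (at C (shift x v) <ᵇ suc (suc w)))
                                 ≡ iverson ((v <ᵇ at L v) ∧ (at L v <ᵇ w))
      old-arcs v v< rewrite child-at-shift v v< | shift-<ᵇ k v (at L v) | shift<ᵇ-high k (at L v) w k≤w = refl

    private
      k<length-heights : suc k ≤ length (heights L)
      k<length-heights = P.subst (suc k ≤_) (sym (length-heights L)) (s≤s k≤)
      k<length-closedProfile : suc k ≤ length (closedProfile L)
      k<length-closedProfile = P.subst (suc k ≤_) (sym (length-closedProfile L)) (s≤s k≤)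

    heights-child : heights C ≡ heightStep (heights L) k
    heights-child = trans (cong (λ m → map (height C) (upTo (suc m))) length-child)
      (map-upTo-ext (3 + len) (height C) (heightStep (heights L) k)
        (trans length-heightStep (cong (2 +_) (length-heights L))) entries)
      where
      open StepEntries (heights L) k k<length-heights
      entries : ∀ i → i < 3 + len → height C i ≡ at (heightStep (heights L) k) i
      entries zero _ = height-child-0
      entries (suc w) i< with w <? suc k
      ... | yes (s≤s w≤k) = trans (height-child-low w w≤k)
            (sym (trans (heightStep-at-low w w≤k) (cong suc (at-map-upTo (suc len) (height L) w (s≤s (≤-trans w≤k k≤))))))
      entries (suc zero) i< | no w≮1+k = ⊥-elim (w≮1+k (s≤s z≤n))
      entries (suc (suc w)) (s≤s (s≤s (s≤s w<len))) | no w≮k = trans (height-child-high w k≤w)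
            (sym (trans (heightStep-at-high w k≤w) (at-map-upTo (suc len) (height L) w (s≤s w<len))))
        where k≤w = ≤-pred (≮⇒≥ w≮k)

    closedProfile-child : closedProfile C ≡ closedStep (closedProfile L) k
    closedProfile-child = trans (cong (λ m → map (closedBefore C) (upTo (suc m))) length-child)
      (map-upTo-ext (3 + len) (closedBefore C) (closedStep (closedProfile L) k)
        (trans length-closedStep (cong (2 +_) (length-closedProfile L))) entries)
      where
      open StepEntries (closedProfile L) k k<length-closedProfile
      entries : ∀ i → i < 3 + len → closedBefore C i ≡ at (closedStep (closedProfile L) k) i
      entries zero _ = closedBefore-child-0
      entries (suc w) i< with w <? suc k
      ... | yes (s≤s w≤k) = trans (closedBefore-child-low w w≤k)
            (sym (trans (closedStep-at-low w w≤k) (at-map-upTo (suc len) (closedBefore L) w (s≤s (≤-trans w≤k k≤)))))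
      entries (suc zero) i< | no w≮1+k = ⊥-elim (w≮1+k (s≤s z≤n))
      entries (suc (suc w)) (s≤s (s≤s (s≤s w<len))) | no w≮k = trans (closedBefore-child-high w k≤w)
            (sym (trans (closedStep-at-high w k≤w (P.subst (w <_) (sym (length-closedProfile L)) (s≤s w<len)))
                        (cong suc (at-map-upTo (suc len) (closedBefore L) w (s≤s w<len)))))
        where k≤w = ≤-pred (≮⇒≥ w≮k)

module Descendants where

  open import Data.Nat using (ℕ; zero; suc; _+_; _<_; _≤_; z≤n; s≤s)
  open import Data.Nat.Properties using (+-identityʳ; suc-injective)
  open import Data.List using (List; []; _∷_; _++_; map; length; upTo; applyUpTo; concatMap)
  open import Data.List.Properties using (concatMap-cong; concatMap-map; map-concatMap; concatMap-++; concatMap-pure; ++-identityʳ)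
  open import Data.List.Relation.Binary.Permutation.Propositional using (_↭_; ↭-refl; ↭-reflexive; ↭-sym; module PermutationReasoning)
  open import Data.List.Relation.Binary.Permutation.Propositional.Properties using (++⁺)
  open import Relation.Binary.PropositionalEquality as P using (_≡_; refl; cong; cong₂; sym; trans)
  open import Function using (_∘_)
  open import Defs using (at; child; children; tree; cr; ne; CrossingSimilar; NestingSimilar)
  open Polynomial
  open SymmetricFunctions
  open ListLookup using (at-map-upTo)
  open Children

  -- tree L (l + 1) takes the children of the last generation; descendants
  -- recurses through the first one instead, which suits induction on L.
  descendants : List ℕ → ℕ → List (List ℕ)
  descendants L zero = L ∷ []
  descendants L (suc l) = concatMap (λ C → descendants C l) (children L)

  concatMap-concatMap : ∀ {A B C : Set} (f : B → List C) (g : A → List B) xs →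
    concatMap f (concatMap g xs) ≡ concatMap (concatMap f ∘ g) xs
  concatMap-concatMap f g [] = refl
  concatMap-concatMap f g (x ∷ xs) =
    trans (concatMap-++ f (g x) (concatMap g xs)) (cong (concatMap f (g x) ++_) (concatMap-concatMap f g xs))

  descendants-suc : ∀ l L → descendants L (suc l) ≡ concatMap children (descendants L l)
  descendants-suc zero L = trans (concatMap-pure (children L)) (sym (++-identityʳ (children L)))
  descendants-suc (suc l) L = trans (concatMap-cong (λ C → descendants-suc l C) (children L))
    (sym (concatMap-concatMap children (λ C → descendants C l) (children L)))

  tree≡descendants : ∀ L l → tree L l ≡ descendants L l
  tree≡descendants L zero = refl
  tree≡descendants L (suc l) = trans (cong (concatMap children) (tree≡descendants L l)) (sym (descendants-suc l L))

  concatMap-applyUpTo : ∀ {A : Set} m (h : ℕ → List A) (g : ℕ → ℕ) → concatMap h (applyUpTo g m) ≡ ⨁ m (h ∘ g)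
  concatMap-applyUpTo zero h g = refl
  concatMap-applyUpTo (suc m) h g = cong (h (g 0) ++_) (concatMap-applyUpTo m h (g ∘ suc))

  ⨁-cong< : ∀ {A : Set} m {f g : ℕ → List A} (R : List A → List A → Set) →
    (∀ {a b c d} → R a b → R c d → R (a ++ c) (b ++ d)) → R [] [] →
    (∀ p → p < m → R (f p) (g p)) → R (⨁ m f) (⨁ m g)
  ⨁-cong< zero R ++-cong []-refl e = []-refl
  ⨁-cong< (suc m) R ++-cong []-refl e =
    ++-cong (e 0 (s≤s z≤n)) (⨁-cong< m R ++-cong []-refl (λ p p< → e (suc p) (s≤s p<)))

  map-descendants-suc : ∀ {A : Set} (f : List ℕ → A) l L →
    map f (descendants L (suc l)) ≡ ⨁ (suc (length L)) (λ k → map f (descendants (child L (suc k)) l))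
  map-descendants-suc f l L = trans (map-concatMap f (λ C → descendants C l) (children L))
    (trans (concatMap-map (map f ∘ (λ C → descendants C l)) (λ k → child L (suc k)) (upTo (suc (length L))))
      (concatMap-applyUpTo (suc (length L)) _ (λ x → x)))

  cr-descendants : ∀ l L → map cr (descendants L l) ↭ q^ (cr L) ⊗ Ψ l 0 (heights L)
  cr-descendants zero L = ↭-reflexive (cong (_∷ []) (sym (+-identityʳ (cr L))))
  cr-descendants (suc l) L = begin
    map cr (descendants L (suc l))
      ≡⟨ map-descendants-suc cr l L ⟩
    ⨁ (suc len) (λ k → map cr (descendants (child L (suc k)) l))
      ↭⟨ ⨁-cong< (suc len) _↭_ ++⁺ ↭-refl per-child ⟩
    ⨁ (suc len) (λ k → q^ (cr L) ⊗ term k)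
      ↭⟨ ⨁-⊗ (suc len) (q^ (cr L)) term ⟩
    q^ (cr L) ⊗ ⨁ (suc len) term
      ≡⟨ cong (λ m → q^ (cr L) ⊗ ⨁ m term) (sym (length-heights L)) ⟩
    q^ (cr L) ⊗ Ψ (suc l) 0 (heights L) ∎
    where
    open PermutationReasoning
    len = length L
    term : ℕ → Poly
    term k = q^ (at (heights L) k) ⊗ Ψ l 0 (heightStep (heights L) k)
    per-child : ∀ k → k < suc len → map cr (descendants (child L (suc k)) l) ↭ q^ (cr L) ⊗ term k
    per-child k (s≤s k≤) = begin
      map cr (descendants (child L (suc k)) l)
        ↭⟨ cr-descendants l (child L (suc k)) ⟩
      q^ (cr (child L (suc k))) ⊗ Ψ l 0 (heights (child L (suc k)))
        ≡⟨ cong₂ (λ a b → q^ a ⊗ Ψ l 0 b) (ChildOf.cr-child L k k≤) (ChildOf.heights-child L k k≤) ⟩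
      q^ (height L k + cr L) ⊗ Ψ l 0 (heightStep (heights L) k)
        ≡⟨ cong (λ a → q^ (a + cr L) ⊗ Ψ l 0 (heightStep (heights L) k)) (sym (at-map-upTo (suc len) (height L) k (s≤s k≤))) ⟩
      (q^ (at (heights L) k) ⊗ q^ (cr L)) ⊗ Ψ l 0 (heightStep (heights L) k)
        ↭⟨ ⊗-congˡ (Ψ l 0 (heightStep (heights L) k)) (⊗-comm (q^ (at (heights L) k)) (q^ (cr L))) ⟩
      (q^ (cr L) ⊗ q^ (at (heights L) k)) ⊗ Ψ l 0 (heightStep (heights L) k)
        ≡⟨ ⊗-assoc (q^ (cr L)) (q^ (at (heights L) k)) _ ⟩
      q^ (cr L) ⊗ term k ∎

  ne-descendants : ∀ l L K → ne L ≡ ne K → closedProfile L ≡ closedProfile K →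
    map ne (descendants L l) ≡ map ne (descendants K l)
  ne-descendants zero L K ne≡ _ = cong (_∷ []) ne≡
  ne-descendants (suc l) L K ne≡ profile≡ =
    trans (map-descendants-suc ne l L)
      (trans (cong (λ m → ⨁ m (λ k → map ne (descendants (child L (suc k)) l))) 1+len≡)
        (trans (⨁-cong< (suc (length K)) _≡_ (cong₂ _++_) refl per-child)
          (sym (map-descendants-suc ne l K))))
    where
    1+len≡ : suc (length L) ≡ suc (length K)
    1+len≡ = trans (sym (length-closedProfile L)) (trans (cong length profile≡) (length-closedProfile K))
    per-child : ∀ k → k < suc (length K) → map ne (descendants (child L (suc k)) l) ≡ map ne (descendants (child K (suc k)) l)
    per-child k (s≤s k≤K) = ne-descendants l (child L (suc k)) (child K (suc k))
        (trans (ChildOf.ne-child L k k≤L) (trans (cong₂ _+_ closed≡ ne≡) (sym (ChildOf.ne-child K k k≤K))))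
        (trans (ChildOf.closedProfile-child L k k≤L)
          (trans (cong (λ s → closedStep s k) profile≡) (sym (ChildOf.closedProfile-child K k k≤K))))
      where
      k≤L : k ≤ length L
      k≤L = P.subst (k ≤_) (sym (suc-injective 1+len≡)) k≤K
      closed≡ : closedBefore L k ≡ closedBefore K k
      closed≡ = trans (sym (at-map-upTo (suc (length L)) (closedBefore L) k (s≤s k≤L)))
        (trans (cong (λ s → at s k) profile≡) (at-map-upTo (suc (length K)) (closedBefore K) k (s≤s k≤K)))

  crossingSimilar : ∀ L K → cr L ≡ cr K → heights L ↭ heights K → CrossingSimilar L K
  crossingSimilar L K cr≡ heights↭ l = begin
    map cr (tree L l)                 ≡⟨ cong (map cr) (tree≡descendants L l) ⟩
    map cr (descendants L l)          ↭⟨ cr-descendants l L ⟩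
    q^ (cr L) ⊗ Ψ l 0 (heights L)     ↭⟨ ⊗-cong (↭-reflexive (cong q^ cr≡)) (Ψ-↭ l 0 heights↭) ⟩
    q^ (cr K) ⊗ Ψ l 0 (heights K)     ↭⟨ ↭-sym (cr-descendants l K) ⟩
    map cr (descendants K l)          ≡⟨ cong (map cr) (sym (tree≡descendants K l)) ⟩
    map cr (tree K l)                 ∎
    where open PermutationReasoning

  nestingSimilar : ∀ L K → ne L ≡ ne K → closedProfile L ≡ closedProfile K → NestingSimilar L K
  nestingSimilar L K ne≡ profile≡ l = ↭-reflexive (begin
    map ne (tree L l)         ≡⟨ cong (map ne) (tree≡descendants L l) ⟩
    map ne (descendants L l)  ≡⟨ ne-descendants l L K ne≡ profile≡ ⟩
    map ne (descendants K l)  ≡⟨ cong (map ne) (sym (tree≡descendants K l)) ⟩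
    map ne (tree K l)         ∎)
    where open P.≡-Reasoning

module MultisetCancellation where

  open import Data.Nat using (ℕ; zero; suc; _+_; _≡ᵇ_)
  open import Data.Nat.Properties
  open import Data.Bool using (true; false)
  open import Data.List using (List; []; _∷_; _++_; map)
  open import Data.List.Relation.Binary.Permutation.Propositional hiding (trans; refl)
  open import Data.Product using (∃; _,_)
  open import Relation.Binary.PropositionalEquality using (_≡_; refl; cong; cong₂; sym; trans; module ≡-Reasoning)
  open import Data.Empty using (⊥-elim)
  open BoolArith using (iverson; ≡ᵇ-refl; ≡ᵇ-true⇒≡)

  multiplicity : ℕ → List ℕ → ℕ
  multiplicity v [] = 0
  multiplicity v (x ∷ xs) = iverson (x ≡ᵇ v) + multiplicity v xs

  multiplicity-++ : ∀ v xs ys → multiplicity v (xs ++ ys) ≡ multiplicity v xs + multiplicity v ys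
  multiplicity-++ v [] ys = refl
  multiplicity-++ v (x ∷ xs) ys = trans (cong (iverson (x ≡ᵇ v) +_) (multiplicity-++ v xs ys))
      (sym (+-assoc (iverson (x ≡ᵇ v)) (multiplicity v xs) (multiplicity v ys)))

  multiplicity-↭ : ∀ v {xs ys} → xs ↭ ys → multiplicity v xs ≡ multiplicity v ys
  multiplicity-↭ v _↭_.refl = refl
  multiplicity-↭ v (prep x p) = cong (iverson (x ≡ᵇ v) +_) (multiplicity-↭ v p)
  multiplicity-↭ v (swap x y p) = trans (sym (+-assoc (iverson (x ≡ᵇ v)) _ _))
      (trans (cong₂ _+_ (+-comm (iverson (x ≡ᵇ v)) (iverson (y ≡ᵇ v))) (multiplicity-↭ v p)) (+-assoc (iverson (y ≡ᵇ v)) _ _))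
  multiplicity-↭ v (_↭_.trans p q) = trans (multiplicity-↭ v p) (multiplicity-↭ v q)

  multiplicity-0-map-suc : ∀ xs → multiplicity 0 (map suc xs) ≡ 0
  multiplicity-0-map-suc [] = refl
  multiplicity-0-map-suc (x ∷ xs) = multiplicity-0-map-suc xs

  multiplicity-map-suc : ∀ v xs → multiplicity (suc v) (map suc xs) ≡ multiplicity v xs
  multiplicity-map-suc v [] = refl
  multiplicity-map-suc v (x ∷ xs) = cong (iverson (x ≡ᵇ v) +_) (multiplicity-map-suc v xs)

  ↭-extract : ∀ x ys c → multiplicity x ys ≡ suc c → ∃ λ ys' → ys ↭ x ∷ ys'
  ↭-extract x [] c ()
  ↭-extract x (y ∷ ys) c e with y ≡ᵇ x in eq
  ... | true = ys , ↭-reflexive (cong (_∷ ys) (≡ᵇ-true⇒≡ eq))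
  ... | false with ↭-extract x ys c e
  ... | ys' , p = (y ∷ ys') , _↭_.trans (prep y p) (swap y x ↭-refl)

  multiplicity≡⇒↭ : ∀ xs ys → (∀ v → multiplicity v xs ≡ multiplicity v ys) → xs ↭ ys
  multiplicity≡⇒↭ [] [] e = ↭-refl
  multiplicity≡⇒↭ [] (y ∷ ys) e with e y
  ... | h rewrite ≡ᵇ-refl y = ⊥-elim (0≢1+n h)
  multiplicity≡⇒↭ (x ∷ xs) ys e with ↭-extract x ys (multiplicity x xs)
      (trans (sym (e x)) (cong (_+ multiplicity x xs) (cong iverson (≡ᵇ-refl x))))
  ... | ys' , p = _↭_.trans (prep x (multiplicity≡⇒↭ xs ys'
      (λ v → +-cancelˡ-≡ (iverson (x ≡ᵇ v)) _ _ (trans (e v) (multiplicity-↭ v p)))))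
      (↭-sym p)

  -- Multiplicities of v + 1 on both sides give m_v(A) + m_(v+1)(C) = m_(v+1)(A) + m_v(C),
  -- so m_v(A) = m_v(C) propagates upwards from v = 0.
  map-suc-cancel : ∀ A C → map suc A ++ C ↭ A ++ map suc C → A ↭ C
  map-suc-cancel A C p = multiplicity≡⇒↭ A C multiplicity≡
    where
    open ≡-Reasoning
    m : ℕ → List ℕ → ℕ
    m = multiplicity
    multiplicity-shifted : ∀ v → m v (map suc A) + m v C ≡ m v A + m v (map suc C)
    multiplicity-shifted v = trans (sym (multiplicity-++ v (map suc A) C)) (trans (multiplicity-↭ v p) (multiplicity-++ v A (map suc C)))
    multiplicity≡ : ∀ v → m v A ≡ m v C
    multiplicity≡ zero = begin
      m 0 A                        ≡⟨ sym (+-identityʳ (m 0 A)) ⟩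
      m 0 A + 0                    ≡⟨ cong (m 0 A +_) (sym (multiplicity-0-map-suc C)) ⟩
      m 0 A + m 0 (map suc C)      ≡⟨ sym (multiplicity-shifted 0) ⟩
      m 0 (map suc A) + m 0 C      ≡⟨ cong (_+ m 0 C) (multiplicity-0-map-suc A) ⟩
      m 0 C                        ∎
    multiplicity≡ (suc v) = +-cancelˡ-≡ (m v C) (m (suc v) A) (m (suc v) C) (begin
      m v C + m (suc v) A                    ≡⟨ +-comm (m v C) (m (suc v) A) ⟩
      m (suc v) A + m v C                    ≡⟨ cong (m (suc v) A +_) (sym (multiplicity-map-suc v C)) ⟩
      m (suc v) A + m (suc v) (map suc C)    ≡⟨ sym (multiplicity-shifted (suc v)) ⟩
      m (suc v) (map suc A) + m (suc v) C
        ≡⟨ cong (_+ m (suc v) C) (trans (multiplicity-map-suc v A) (multiplicity≡ v)) ⟩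
      m v C + m (suc v) C                    ∎)

module StepSequences where

  open import Data.Nat using (ℕ; zero; suc; _+_; _^_; _<_; _≤_; z≤n; s≤s)
  open import Data.Nat.Properties
  open import Data.List using (List; []; _∷_; _++_; map; length; upTo)
  open import Data.List.Properties using (length-map; length-++; map-applyUpTo)
  open import Data.List.Membership.Propositional using (_∈_)
  open import Data.List.Membership.Propositional.Properties using (∈-map⁺; ∈-++⁺ˡ; ∈-++⁺ʳ)
  open import Data.List.Relation.Unary.Any using (here; there)
  open import Data.List.Relation.Unary.All as All using (All)
  open import Data.List.Relation.Unary.AllPairs using (AllPairs; []; _∷_)
  open import Data.Sum using (_⊎_; inj₁; inj₂)
  open import Relation.Binary.PropositionalEquality as P using (_≡_; refl; cong; cong₂; sym; trans)
  open import Relation.Binary.Definitions using (tri<; tri≈; tri>)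
  open import Data.Empty using (⊥-elim)
  open import Function using (_∘_)

  stepSeqs : ℕ → ℕ → List (List ℕ)
  stepSeqs v zero = (v ∷ []) ∷ []
  stepSeqs v (suc m) = map (v ∷_) (stepSeqs v m ++ stepSeqs (suc v) m)

  stepSeqs₀ : ℕ → List (List ℕ)
  stepSeqs₀ zero = [] ∷ []
  stepSeqs₀ (suc m) = stepSeqs 0 m

  length-stepSeqs : ∀ v m → length (stepSeqs v m) ≡ 2 ^ m
  length-stepSeqs v zero = refl
  length-stepSeqs v (suc m) = begin
    length (map (v ∷_) (stepSeqs v m ++ stepSeqs (suc v) m))
      ≡⟨ length-map (v ∷_) (stepSeqs v m ++ stepSeqs (suc v) m) ⟩
    length (stepSeqs v m ++ stepSeqs (suc v) m)              ≡⟨ length-++ (stepSeqs v m) ⟩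
    length (stepSeqs v m) + length (stepSeqs (suc v) m)
      ≡⟨ cong₂ _+_ (length-stepSeqs v m) (length-stepSeqs (suc v) m) ⟩
    2 ^ m + 2 ^ m                                            ≡⟨ cong (2 ^ m +_) (sym (+-identityʳ (2 ^ m))) ⟩
    2 ^ suc m                                                ∎
    where open P.≡-Reasoning

  length-stepSeqs₀ : ∀ m → length (stepSeqs₀ m) ≤ 2 ^ m
  length-stepSeqs₀ zero = ≤-refl
  length-stepSeqs₀ (suc m) = ≤-trans (≤-reflexive (length-stepSeqs 0 m)) (m≤m+n (2 ^ m) (2 ^ m + 0))

  map-upTo-suc : ∀ m (f : ℕ → ℕ) → map f (upTo (suc m)) ≡ f 0 ∷ map (f ∘ suc) (upTo m)
  map-upTo-suc m f = cong (f 0 ∷_) (trans (map-applyUpTo suc f m) (sym (map-applyUpTo (λ x → x) (f ∘ suc) m)))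

  map-upTo∈stepSeqs : ∀ m (f : ℕ → ℕ) → (∀ i → i < m → f (suc i) ≡ f i ⊎ f (suc i) ≡ suc (f i)) →
    map f (upTo (suc m)) ∈ stepSeqs (f 0) m
  map-upTo∈stepSeqs zero f st = here refl
  map-upTo∈stepSeqs (suc m) f st rewrite map-upTo-suc (suc m) f
      with st 0 (s≤s z≤n) | map-upTo∈stepSeqs m (f ∘ suc) (λ i i< → st (suc i) (s≤s i<))
  ... | inj₁ e | r rewrite e = ∈-map⁺ (f 0 ∷_) (∈-++⁺ˡ r)
  ... | inj₂ e | r rewrite e = ∈-map⁺ (f 0 ∷_) (∈-++⁺ʳ (stepSeqs (f 0) m) r)

  DownClosedAbove : ℕ → List ℕ → Set
  DownClosedAbove a xs = ∀ u v → u ∈ xs → a ≤ v → v < u → v ∈ xs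

  DownClosed : List ℕ → Set
  DownClosed xs = ∀ u v → u ∈ xs → v < u → v ∈ xs

  private
    head≤ : ∀ {b x rest} → All (b ≤_) rest → x ∈ (b ∷ rest) → b ≤ x
    head≤ al (here refl) = ≤-refl
    head≤ al (there m) = All.lookup al m

  sorted∈stepSeqs : ∀ a rest → AllPairs _≤_ (a ∷ rest) → DownClosedAbove a (a ∷ rest) →
    (a ∷ rest) ∈ stepSeqs a (length rest)
  sorted∈stepSeqs a [] ap dc = here refl
  sorted∈stepSeqs a (b ∷ rest) ((ab All.∷ _) ∷ ap) dc with <-cmp b (suc a)
  ... | tri< b<sa _ _ with ≤-antisym (≤-pred b<sa) ab
  ...   | refl = ∈-map⁺ (a ∷_) (∈-++⁺ˡ (sorted∈stepSeqs a rest ap dc-tail))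
    where
    dc-tail : DownClosedAbove a (a ∷ rest)
    dc-tail u v um a≤v v<u with dc u v (there um) a≤v v<u
    ... | here e = here e
    ... | there m = m
  sorted∈stepSeqs a (b ∷ rest) ((ab All.∷ _) ∷ ap) dc | tri≈ _ refl _ =
      ∈-map⁺ (a ∷_) (∈-++⁺ʳ (stepSeqs a (length rest)) (sorted∈stepSeqs (suc a) rest ap dc-tail))
    where
    dc-tail : DownClosedAbove (suc a) (suc a ∷ rest)
    dc-tail u v um sa≤v v<u with dc u v (there um) (≤-trans (n≤1+n a) sa≤v) v<u
    ... | here refl = ⊥-elim (1+n≰n sa≤v)
    ... | there m = m
  sorted∈stepSeqs a (b ∷ rest) ((ab All.∷ _) ∷ ap) dc | tri> _ _ sa<b with dc b (suc a) (there (here refl)) (n≤1+n a) sa<b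
  ... | here e = ⊥-elim (1+n≢n e)
  ... | there m = ⊥-elim (<⇒≱ sa<b (head≤ (hd ap) m))
    where
    hd : AllPairs _≤_ (b ∷ rest) → All (b ≤_) rest
    hd (h ∷ _) = h

  sorted∈stepSeqs₀ : ∀ xs → AllPairs _≤_ xs → DownClosed xs → xs ∈ stepSeqs₀ (length xs)
  sorted∈stepSeqs₀ [] _ _ = here refl
  sorted∈stepSeqs₀ (zero ∷ rest) ap dc = sorted∈stepSeqs 0 rest ap (λ u v um _ v<u → dc u v um v<u)
  sorted∈stepSeqs₀ (suc a ∷ rest) (h ∷ ap) dc with dc (suc a) a (here refl) ≤-refl
  ... | here e = ⊥-elim (1+n≢n (sym e))
  ... | there m = ⊥-elim (1+n≰n (All.lookup h m))

module MatchingProfiles where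

  open import Data.Nat using (ℕ; zero; suc; _+_; _*_; _<_; _≤_; z≤n; s≤s; _<ᵇ_; _≡ᵇ_; _<?_)
  open import Data.Nat.Properties
  open import Data.Bool using (Bool; true; false; _∧_; not; if_then_else_)
  open import Data.Bool.Properties using (∧-zeroʳ; ∧-identityʳ; not-involutive)
  open import Data.List using (List; []; _∷_; _++_; _∷ʳ_; map; length; upTo; applyUpTo)
  open import Data.List.Properties using (length-map; length-++; map-applyUpTo; map-++; map-∘; map-upTo; upTo-∷ʳ)
  open import Data.List.Membership.Propositional using (_∈_)
  open import Data.List.Relation.Unary.Any using (here; there)
  open import Data.List.Relation.Binary.Permutation.Propositional
    using (_↭_; prep; ↭-refl; ↭-sym; ↭-trans; module PermutationReasoning)
  open import Data.List.Relation.Binary.Permutation.Propositional.Properties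
    using (++⁺ˡ; drop-∷; ↭-length; ++-comm) renaming (shift to ↭-shift)
  open import Data.Product using (_×_; _,_; proj₁; proj₂; ∃)
  open import Data.Sum using (_⊎_; inj₁; inj₂)
  open import Relation.Binary.PropositionalEquality as P using (_≡_; _≢_; refl; cong; cong₂; sym; trans; module ≡-Reasoning)
  open import Relation.Binary.Definitions using (tri<; tri≈; tri>)
  open import Relation.Nullary using (yes; no)
  open import Data.Empty using (⊥-elim)
  open import Function using (_∘_)
  open import Defs using (at; IsMatching)
  open BoolArith
  open FiniteSums
  open ListLookup using (length-map-upTo)
  open Children using (height; closedBefore; heights; closedProfile)
  open MultisetCancellation using (map-suc-cancel)
  open StepSequences

  select : (ℕ → Bool) → List ℕ → List ℕ
  select b [] = []
  select b (x ∷ xs) = if b x then x ∷ select b xs else select b xs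

  map-select-partition : ∀ (f : ℕ → ℕ) b xs → map f xs ↭ map f (select b xs) ++ map f (select (not ∘ b) xs)
  map-select-partition f b [] = ↭-refl
  map-select-partition f b (x ∷ xs) with b x
  ... | true = prep (f x) (map-select-partition f b xs)
  ... | false = ↭-trans (prep (f x) (map-select-partition f b xs)) (↭-sym (↭-shift (f x) (map f (select b xs)) _))

  map-select-cong : ∀ m (s : ℕ → ℕ) b (f g : ℕ → ℕ) → (∀ i → i < m → b (s i) ≡ true → f (s i) ≡ g (s i)) →
    map f (select b (applyUpTo s m)) ≡ map g (select b (applyUpTo s m))
  map-select-cong zero s b f g e = refl
  map-select-cong (suc m) s b f g e with b (s 0) in eq
  ... | true = cong₂ _∷_ (e 0 (s≤s z≤n) eq) (map-select-cong m (s ∘ suc) b f g (λ i i< → e (suc i) (s≤s i<)))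
  ... | false = map-select-cong m (s ∘ suc) b f g (λ i i< → e (suc i) (s≤s i<))

  ∈-map-select : ∀ m (s : ℕ → ℕ) b (f : ℕ → ℕ) i → i < m → b (s i) ≡ true → f (s i) ∈ map f (select b (applyUpTo s m))
  ∈-map-select (suc m) s b f zero _ e rewrite e = here refl
  ∈-map-select (suc m) s b f (suc i) (s≤s i<) e with b (s 0)
  ... | true = there (∈-map-select m (s ∘ suc) b f i i< e)
  ... | false = ∈-map-select m (s ∘ suc) b f i i< e

  map-select-∈ : ∀ m (s : ℕ → ℕ) b (f : ℕ → ℕ) u → u ∈ map f (select b (applyUpTo s m)) →
      ∃ λ i → i < m × b (s i) ≡ true × f (s i) ≡ u
  map-select-∈ (suc m) s b f u mem with b (s 0) in eq
  map-select-∈ (suc m) s b f u (here e) | true = 0 , s≤s z≤n , eq , sym e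
  map-select-∈ (suc m) s b f u (there mem) | true with map-select-∈ m (s ∘ suc) b f u mem
  ... | i , i< , bi , fi = suc i , s≤s i< , bi , fi
  map-select-∈ (suc m) s b f u mem | false with map-select-∈ m (s ∘ suc) b f u mem
  ... | i , i< , bi , fi = suc i , s≤s i< , bi , fi

  m+m≡n+n⇒m≡n : ∀ m n → m + m ≡ n + n → m ≡ n
  m+m≡n+n⇒m≡n zero zero e = refl
  m+m≡n+n⇒m≡n zero (suc n) ()
  m+m≡n+n⇒m≡n (suc m) zero ()
  m+m≡n+n⇒m≡n (suc m) (suc n) e = cong suc (m+m≡n+n⇒m≡n m n
      (suc-injective (trans (sym (+-suc m m)) (trans (suc-injective e) (+-suc n n)))))

  iverson-not-<ᵇ-suc : ∀ y p → iverson (not (y <ᵇ suc p)) + iverson (y ≡ᵇ p) ≡ iverson (not (y <ᵇ p))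
  iverson-not-<ᵇ-suc zero zero = refl
  iverson-not-<ᵇ-suc zero (suc p) = refl
  iverson-not-<ᵇ-suc (suc y) zero = refl
  iverson-not-<ᵇ-suc (suc y) (suc p) = iverson-not-<ᵇ-suc y p

  height-summand-step : ∀ j p y → iverson ((j <ᵇ suc p) ∧ not (y <ᵇ suc p)) + iverson ((y ≡ᵇ p) ∧ (j <ᵇ p))
      ≡ iverson ((j <ᵇ p) ∧ not (y <ᵇ p)) + iverson ((j ≡ᵇ p) ∧ (p <ᵇ y))
  height-summand-step zero zero zero = refl
  height-summand-step zero zero (suc y) = refl
  height-summand-step zero (suc p) y = trans (cong (λ b → iverson (not (y <ᵇ suc (suc p))) + iverson b) (∧-identityʳ _))
      (trans (iverson-not-<ᵇ-suc y (suc p)) (sym (+-identityʳ _)))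
  height-summand-step (suc j) zero y = cong (λ b → iverson b) (∧-zeroʳ (y ≡ᵇ 0))
  height-summand-step (suc j) (suc p) zero rewrite ∧-zeroʳ (j <ᵇ suc p) | ∧-zeroʳ (j <ᵇ p) | ∧-zeroʳ (j ≡ᵇ p) = refl
  height-summand-step (suc j) (suc p) (suc y) = height-summand-step j p y

  iverson-<ᵇ-suc : ∀ y p → iverson (y <ᵇ suc p) ≡ iverson (y <ᵇ p) + iverson (y ≡ᵇ p)
  iverson-<ᵇ-suc zero zero = refl
  iverson-<ᵇ-suc zero (suc p) = refl
  iverson-<ᵇ-suc (suc y) zero = refl
  iverson-<ᵇ-suc (suc y) (suc p) = iverson-<ᵇ-suc y p

  closed-summand-step : ∀ c y p → iverson (c ∧ (y <ᵇ suc p)) ≡ iverson (c ∧ (y <ᵇ p)) + iverson (c ∧ (y ≡ᵇ p))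
  closed-summand-step true y p = iverson-<ᵇ-suc y p
  closed-summand-step false y p = refl

  opens : List ℕ → ℕ → Bool
  opens L p = p <ᵇ at L p

  openerHeights : List ℕ → List ℕ
  openerHeights L = map (height L) (select (opens L) (upTo (length L)))

  module Matching (n : ℕ) (L : List ℕ) (M : IsMatching n L) where

    len = length L

    length≡2n : len ≡ 2 * n
    length≡2n = proj₁ M

    private
      facts : ∀ i → i < len → (at L i < 2 * n) × (at L (at L i) ≡ i) × (at L i ≢ i)
      facts i i< = proj₂ M i (P.subst (i <_) length≡2n i<)

    partner< : ∀ i → i < len → at L i < len
    partner< i i< = P.subst (at L i <_) (sym length≡2n) (proj₁ (facts i i<))

    partner-involutive : ∀ i → i < len → at L (at L i) ≡ i
    partner-involutive i i< = proj₁ (proj₂ (facts i i<))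

    partner≢ : ∀ i → i < len → at L i ≢ i
    partner≢ i i< = proj₂ (proj₂ (facts i i<))

    partner-injective : ∀ {j p} → j < len → at L j ≡ p → j ≡ at L p
    partner-injective {j} j< e = trans (sym (partner-involutive j j<)) (cong (at L) e)

    h : ℕ → ℕ
    h = height L

    height-step : ∀ p → p < len → h (suc p) + iverson (at L p <ᵇ p) ≡ h p + iverson (p <ᵇ at L p)
    height-step p p< = begin
      h (suc p) + iverson (at L p <ᵇ p)
        ≡⟨ cong (h (suc p) +_) (sym closing) ⟩
      h (suc p) + ∑ len X                                                   ≡⟨ sym (∑-+ len _ X) ⟩
      ∑ len (λ j → iverson ((j <ᵇ suc p) ∧ not (at L j <ᵇ suc p)) + X j)
        ≡⟨ ∑-cong len (λ j _ → height-summand-step j p (at L j)) ⟩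
      ∑ len (λ j → iverson ((j <ᵇ p) ∧ not (at L j <ᵇ p)) + Y j)            ≡⟨ ∑-+ len _ Y ⟩
      h p + ∑ len Y                                                         ≡⟨ cong (h p +_) opening ⟩
      h p + iverson (p <ᵇ at L p)                                           ∎
      where
      open ≡-Reasoning
      X Y : ℕ → ℕ
      X j = iverson ((at L j ≡ᵇ p) ∧ (j <ᵇ p))
      Y j = iverson ((j ≡ᵇ p) ∧ (p <ᵇ at L j))
      closing : ∑ len X ≡ iverson (at L p <ᵇ p)
      closing = trans (∑-single len (at L p) X (partner< p p<) others) at-partner
        where
        others : ∀ j → j < len → j ≢ at L p → X j ≡ 0
        others j j< j≢ rewrite ≢⇒≡ᵇ-false {at L j} {p} (j≢ ∘ partner-injective j<) = refl
        at-partner : X (at L p) ≡ iverson (at L p <ᵇ p)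
        at-partner rewrite partner-involutive p p< | ≡ᵇ-refl p = refl
      opening : ∑ len Y ≡ iverson (p <ᵇ at L p)
      opening = trans (∑-single len p Y p< others) at-p
        where
        others : ∀ j → j < len → j ≢ p → Y j ≡ 0
        others j j< j≢p rewrite ≢⇒≡ᵇ-false j≢p = refl
        at-p : Y p ≡ iverson (p <ᵇ at L p)
        at-p rewrite ≡ᵇ-refl p = refl

    closedBefore-step : ∀ p → p < len → closedBefore L (suc p) ≡ closedBefore L p + iverson (at L p <ᵇ p)
    closedBefore-step p p< = trans (∑-cong len (λ j _ → closed-summand-step (j <ᵇ at L j) (at L j) p))
      (trans (∑-+ len _ Z) (cong (closedBefore L p +_) closing))
      where
      Z : ℕ → ℕ
      Z j = iverson ((j <ᵇ at L j) ∧ (at L j ≡ᵇ p))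
      closing : ∑ len Z ≡ iverson (at L p <ᵇ p)
      closing = trans (∑-single len (at L p) Z (partner< p p<) others) at-partner
        where
        others : ∀ j → j < len → j ≢ at L p → Z j ≡ 0
        others j j< j≢ rewrite ≢⇒≡ᵇ-false {at L j} {p} (j≢ ∘ partner-injective j<) = cong iverson (∧-zeroʳ _)
        at-partner : Z (at L p) ≡ iverson (at L p <ᵇ p)
        at-partner rewrite partner-involutive p p< | ≡ᵇ-refl p = cong iverson (∧-identityʳ _)

    height-0 : h 0 ≡ 0
    height-0 = ∑-zero len (λ _ _ → refl)

    height-end : h len ≡ 0
    height-end = ∑-zero len (λ j j< → cong iverson (trans (cong ((j <ᵇ len) ∧_) (cong not (<ᵇ-true (partner< j j<)))) (∧-zeroʳ _)))

    closedBefore-0 : closedBefore L 0 ≡ 0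
    closedBefore-0 = ∑-zero len (λ _ _ → cong iverson (∧-zeroʳ _))

    closes-below : ∀ p → p < len → opens L p ≡ false → at L p < p
    closes-below p p< closes with <-cmp (at L p) p
    ... | tri< lt _ _ = lt
    ... | tri≈ _ eq _ = ⊥-elim (partner≢ p p< eq)
    ... | tri> _ _ gt with trans (sym (<ᵇ-true gt)) closes
    ...   | ()

    height-up : ∀ p → p < len → opens L p ≡ true → h (suc p) ≡ suc (h p)
    height-up p p< opens-p = begin
      h (suc p)                          ≡⟨ sym (+-identityʳ (h (suc p))) ⟩
      h (suc p) + iverson false
        ≡⟨ cong (λ b → h (suc p) + iverson b) (sym (<ᵇ-false {at L p} {p} (<⇒≤ (<ᵇ-true⇒< {p} {at L p} opens-p)))) ⟩
      h (suc p) + iverson (at L p <ᵇ p)  ≡⟨ height-step p p< ⟩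
      h p + iverson (p <ᵇ at L p)        ≡⟨ cong (λ b → h p + iverson b) opens-p ⟩
      h p + 1                            ≡⟨ +-comm (h p) 1 ⟩
      suc (h p)                          ∎
      where open ≡-Reasoning

    height-down : ∀ p → p < len → opens L p ≡ false → h p ≡ suc (h (suc p))
    height-down p p< closes = begin
      h p                                ≡⟨ sym (+-identityʳ (h p)) ⟩
      h p + iverson false                ≡⟨ cong (λ b → h p + iverson b) (sym closes) ⟩
      h p + iverson (p <ᵇ at L p)        ≡⟨ sym (height-step p p<) ⟩
      h (suc p) + iverson (at L p <ᵇ p)
        ≡⟨ cong (λ b → h (suc p) + iverson b) (<ᵇ-true (closes-below p p< closes)) ⟩
      h (suc p) + 1                      ≡⟨ +-comm (h (suc p)) 1 ⟩
      suc (h (suc p))                    ∎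
      where open ≡-Reasoning

    openers closers : List ℕ
    openers = select (opens L) (upTo len)
    closers = select (not ∘ opens L) (upTo len)

    closerHeights : List ℕ
    closerHeights = map (h ∘ suc) closers

    -- Each vertex raises or lowers the height by one.  Listing the gap heights
    -- by the gap after each vertex gives 0 ∷ (map suc (openerHeights L) ++
    -- closerHeights), by the gap before it 0 ∷ (openerHeights L ++ map suc
    -- closerHeights); cancelling yields openerHeights L ↭ closerHeights.
    private
      heights↭via-openers : heights L ↭ 0 ∷ (map suc (openerHeights L) ++ closerHeights)
      heights↭via-openers = begin
        h 0 ∷ map h (applyUpTo suc len)
          ≡⟨ cong₂ _∷_ height-0 (trans (map-applyUpTo suc h len) (sym (map-upTo (h ∘ suc) len))) ⟩
        0 ∷ map (h ∘ suc) (upTo len)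
          ↭⟨ prep 0 (map-select-partition (h ∘ suc) (opens L) (upTo len)) ⟩
        0 ∷ (map (h ∘ suc) openers ++ closerHeights)
          ≡⟨ cong (λ ys → 0 ∷ (ys ++ closerHeights)) openers-rise ⟩
        0 ∷ (map suc (openerHeights L) ++ closerHeights)  ∎
        where
        open PermutationReasoning
        openers-rise : map (h ∘ suc) openers ≡ map suc (openerHeights L)
        openers-rise = trans (map-select-cong len (λ x → x) (opens L) (h ∘ suc) (suc ∘ h) (λ i i< → height-up i i<)) (map-∘ openers)

      heights↭via-closers : heights L ↭ 0 ∷ (openerHeights L ++ map suc closerHeights)
      heights↭via-closers = begin
        map h (upTo (suc len))                        ≡⟨ cong (map h) (sym (upTo-∷ʳ len)) ⟩
        map h (upTo len ∷ʳ len)                       ≡⟨ map-++ h (upTo len) (len ∷ []) ⟩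
        map h (upTo len) ++ h len ∷ []                ↭⟨ ++-comm (map h (upTo len)) (h len ∷ []) ⟩
        h len ∷ map h (upTo len)                      ≡⟨ cong (_∷ map h (upTo len)) height-end ⟩
        0 ∷ map h (upTo len)
          ↭⟨ prep 0 (map-select-partition h (opens L) (upTo len)) ⟩
        0 ∷ (openerHeights L ++ map h closers)
          ≡⟨ cong (λ ys → 0 ∷ (openerHeights L ++ ys)) closers-fall ⟩
        0 ∷ (openerHeights L ++ map suc closerHeights)  ∎
        where
        open PermutationReasoning
        closers-fall : map h closers ≡ map suc closerHeights
        closers-fall = trans (map-select-cong len (λ x → x) (not ∘ opens L) h (suc ∘ (h ∘ suc))
          (λ i i< closes → height-down i i< (trans (sym (not-involutive (opens L i))) (cong not closes)))) (map-∘ closers)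

    openerHeights↭closerHeights : openerHeights L ↭ closerHeights
    openerHeights↭closerHeights = map-suc-cancel (openerHeights L) closerHeights
      (drop-∷ (↭-trans (↭-sym heights↭via-openers) heights↭via-closers))

    heights↭ : heights L ↭ 0 ∷ (map suc (openerHeights L) ++ openerHeights L)
    heights↭ = ↭-trans heights↭via-openers (prep 0 (++⁺ˡ (map suc (openerHeights L)) (↭-sym openerHeights↭closerHeights)))

    length-openerHeights : length (openerHeights L) ≡ n
    length-openerHeights = m+m≡n+n⇒m≡n (length (openerHeights L)) n (suc-injective (begin
      suc (length (openerHeights L) + length (openerHeights L))
        ≡⟨ cong (λ a → suc (a + length (openerHeights L))) (sym (length-map suc (openerHeights L))) ⟩
      suc (length (map suc (openerHeights L)) + length (openerHeights L))
        ≡⟨ cong suc (sym (length-++ (map suc (openerHeights L)))) ⟩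
      length (0 ∷ (map suc (openerHeights L) ++ openerHeights L)) ≡⟨ sym (↭-length heights↭) ⟩
      length (heights L)                                  ≡⟨ length-map-upTo (suc len) h ⟩
      suc len
        ≡⟨ cong suc (trans length≡2n (cong (n +_) (+-identityʳ n))) ⟩
      suc (n + n)                                         ∎))
      where open ≡-Reasoning

    height-attained : ∀ p v → p ≤ len → v < h p → ∃ λ p' → p' < p × opens L p' ≡ true × h p' ≡ v
    height-attained zero v _ v< rewrite height-0 = ⊥-elim (n≮0 v<)
    height-attained (suc p) v sp≤ v< with v <? h p
    ... | yes v<hp with height-attained p v (≤-trans (n≤1+n p) sp≤) v<hp
    ...   | p' , p'< , opens-p' , hp'≡v = p' , m<n⇒m<1+n p'< , opens-p' , hp'≡v
    height-attained (suc p) v sp≤ v< | no v≮hp with opens L p in eq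
    ... | true = p , ≤-refl , eq , ≤-antisym (≮⇒≥ v≮hp) (≤-pred (P.subst (v <_) (height-up p sp≤ eq) v<))
    ... | false = ⊥-elim (v≮hp (<-trans v< (P.subst (h (suc p) <_) (sym (height-down p sp≤ eq)) ≤-refl)))

    openerHeights-downClosed : DownClosed (openerHeights L)
    openerHeights-downClosed u v u∈ v<u with map-select-∈ len (λ x → x) (opens L) h u u∈
    ... | p , p< , _ , refl with height-attained p v (<⇒≤ p<) v<u
    ...   | p' , p'< , opens-p' , refl = ∈-map-select len (λ x → x) (opens L) h p' (<-trans p'< p<) opens-p'

    closedProfile∈stepSeqs : closedProfile L ∈ stepSeqs 0 len
    closedProfile∈stepSeqs = P.subst (λ v → closedProfile L ∈ stepSeqs v len) closedBefore-0
      (map-upTo∈stepSeqs len (closedBefore L) unit-step)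
      where
      unit-step : ∀ i → i < len → closedBefore L (suc i) ≡ closedBefore L i ⊎ closedBefore L (suc i) ≡ suc (closedBefore L i)
      unit-step i i< with at L i <ᵇ i | closedBefore-step i i<
      ... | true | e = inj₂ (trans e (+-comm (closedBefore L i) 1))
      ... | false | e = inj₁ (trans e (+-identityʳ _))

module Pigeonhole where

  open import Data.Nat using (ℕ; suc; _+_; _*_; _≤_; z≤n; s≤s; _≤?_)
  open import Data.Nat.Properties
  open import Data.List using (List; []; _∷_; length; filter)
  open import Data.List.Properties using (≡-dec)
  open import Data.List.Membership.Propositional using (_∈_)
  open import Data.List.Membership.Propositional.Properties using (∈-filter⁻)
  open import Data.List.Relation.Unary.Any using (here; there)
  open import Data.List.Relation.Unary.All as All using (All; []; _∷_)
  open import Data.List.Relation.Unary.AllPairs using (AllPairs; []; _∷_)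
  open import Data.List.Relation.Unary.Unique.Propositional using (Unique)
  open import Data.List.Relation.Unary.Unique.Propositional.Properties using (filter⁺)
  open import Data.Product using (∃; _×_; _,_; proj₁; proj₂)
  open import Data.Empty using (⊥-elim)
  open import Function using (_∘_)
  open import Relation.Binary.PropositionalEquality using (_≡_; refl; cong₂; sym; trans)
  open import Relation.Binary.Definitions using (DecidableEquality)
  open import Relation.Nullary using (yes; no)
  open import Data.Nat.Solver using (module +-*-Solver)
  open +-*-Solver using (solve; _:+_; _:=_)

  _≟ᴸ_ : DecidableEquality (List ℕ)
  _≟ᴸ_ = ≡-dec Data.Nat._≟_

  ∑over : (List ℕ → ℕ) → List (List ℕ) → ℕ
  ∑over f [] = 0
  ∑over f (c ∷ C) = f c + ∑over f C

  ∑over-+ : ∀ f g C → ∑over (λ c → f c + g c) C ≡ ∑over f C + ∑over g C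
  ∑over-+ f g [] = refl
  ∑over-+ f g (c ∷ C) = trans (cong₂ _+_ refl (∑over-+ f g C))
    (solve 4 (λ a b x y → a :+ b :+ (x :+ y) := a :+ x :+ (b :+ y)) refl (f c) (g c) (∑over f C) (∑over g C))

  ∑over-cong : ∀ C {f g : List ℕ → ℕ} → (∀ c → f c ≡ g c) → ∑over f C ≡ ∑over g C
  ∑over-cong [] e = refl
  ∑over-cong (c ∷ C) e = cong₂ _+_ (e c) (∑over-cong C e)

  ∑over≤length*max : ∀ (f : List ℕ → ℕ) C → ∃ λ c → ∑over f C ≤ length C * f c
  ∑over≤length*max f [] = [] , z≤n
  ∑over≤length*max f (c₀ ∷ C) with ∑over≤length*max f C
  ... | c , ∑≤ with f c₀ ≤? f c
  ...   | yes fc₀≤fc = c , +-mono-≤ fc₀≤fc ∑≤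
  ...   | no fc₀≰fc = c₀ , +-monoʳ-≤ (f c₀) (≤-trans ∑≤ (*-monoʳ-≤ (length C) (<⇒≤ (≰⇒> fc₀≰fc))))

  module _ {A : Set} (code : A → List ℕ) where

    fibre : List ℕ → List A → List A
    fibre c X = filter (λ x → code x ≟ᴸ c) X

    length-fibre-∷ : ∀ c x X → length (fibre c (x ∷ X)) ≡ length (fibre c (x ∷ [])) + length (fibre c X)
    length-fibre-∷ c x X with code x ≟ᴸ c
    ... | yes _ = refl
    ... | no _ = refl

    fibre-of-code : ∀ x C → code x ∈ C → 1 ≤ ∑over (λ c → length (fibre c (x ∷ []))) C
    fibre-of-code x (c ∷ C) (here e) with code x ≟ᴸ c
    ... | yes _ = s≤s z≤n
    ... | no code≢c = ⊥-elim (code≢c e)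
    fibre-of-code x (c ∷ C) (there m) = ≤-trans (fibre-of-code x C m) (m≤n+m _ _)

    length≤∑fibres : ∀ C X → All (λ x → code x ∈ C) X → length X ≤ ∑over (λ c → length (fibre c X)) C
    length≤∑fibres C [] _ = z≤n
    length≤∑fibres C (x ∷ X) (m ∷ codes) = begin
      suc (length X)
        ≤⟨ +-mono-≤ (fibre-of-code x C m) (length≤∑fibres C X codes) ⟩
      ∑over (λ c → length (fibre c (x ∷ []))) C + ∑over (λ c → length (fibre c X)) C
        ≡⟨ sym (∑over-+ _ _ C) ⟩
      ∑over (λ c → length (fibre c (x ∷ [])) + length (fibre c X)) C
        ≡⟨ ∑over-cong C (λ c → sym (length-fibre-∷ c x X)) ⟩
      ∑over (λ c → length (fibre c (x ∷ X))) C ∎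
      where open ≤-Reasoning

    allPairs-tabulate : ∀ {R : A → A → Set} (Y : List A) → (∀ {x y} → x ∈ Y → y ∈ Y → R x y) → AllPairs R Y
    allPairs-tabulate [] f = []
    allPairs-tabulate (y ∷ Y) f = All.tabulate (λ m → f (here refl) (there m)) ∷ allPairs-tabulate Y (λ m m' → f (there m) (there m'))

    similarClass : ∀ (Valid : A → Set) (R : A → A → Set) C X → All Valid X → Unique X →
      (∀ L K → Valid L → Valid K → code L ≡ code K → R L K) → All (λ x → code x ∈ C) X →
      ∃ λ Y → Unique Y × All (_∈ X) Y × AllPairs R Y × length X ≤ length C * length Y
    similarClass Valid R C X valid distinct similar codes with ∑over≤length*max (λ c → length (fibre c X)) C
    ... | c , ∑≤ = fibre c X , filter⁺ (λ x → code x ≟ᴸ c) distinct , All.tabulate (proj₁ ∘ member) ,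
        allPairs-tabulate (fibre c X) (λ m m' → similar _ _ (valid-member m) (valid-member m')
            (trans (proj₂ (member m)) (sym (proj₂ (member m'))))) ,
        ≤-trans (length≤∑fibres C X codes) ∑≤
      where
      member : ∀ {y} → y ∈ fibre c X → y ∈ X × code y ≡ c
      member = ∈-filter⁻ (λ x → code x ≟ᴸ c) {xs = X}
      valid-member : ∀ {y} → y ∈ fibre c X → Valid y
      valid-member m = All.lookup valid (proj₁ (member m))

module Growth where

  open import Data.Nat
  open import Data.Nat.Properties
  open import Data.Nat.DivMod using (_/_; _%_; m≡m%n+[m/n]*n; m%n<n)
  open import Data.Nat.Solver using (module +-*-Solver)
  open +-*-Solver
  open import Data.Product using (∃; _,_)
  open import Relation.Binary.PropositionalEquality as P using (_≡_; refl; cong; sym; trans)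
  open import Data.Empty using (⊥-elim)
  open import Relation.Nullary using (yes; no)

  -- The crossing and nesting numbers of a matching on [2n] lie in 0, …, (2n)².
  statRange : ℕ → ℕ
  statRange n = suc ((2 * n) * (2 * n))

  *-^-distrib : ∀ a b n → (a * b) ^ n ≡ a ^ n * b ^ n
  *-^-distrib a b zero = refl
  *-^-distrib a b (suc n) = trans (cong ((a * b) *_) (*-^-distrib a b n)) (solve 4 (λ a b x y → (a :* b) :* (x :* y) := (a :* x) :* (b :* y))
                                                                             refl a b (a ^ n) (b ^ n))

  bernoulli : ∀ K j → K ^ suc j + j * K ^ j ≤ K * (K + 1) ^ j
  bernoulli K zero = ≤-reflexive (solve 1 (λ K → K :* con 1 :+ con 0 := K :* con 1) refl K)
  bernoulli K (suc j) = begin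
    K ^ suc (suc j) + suc j * K ^ suc j ≤⟨ m≤m+n _ (j * K ^ j) ⟩
    K ^ suc (suc j) + suc j * K ^ suc j + j * K ^ j
      ≡⟨ solve 3 (λ K j x → K :* (K :* x) :+ (con 1 :+ j) :* (K :* x) :+ j :* x := (K :+ con 1) :* (K :* x :+ j :* x))
           refl K j (K ^ j) ⟩
    (K + 1) * (K ^ suc j + j * K ^ j) ≤⟨ *-monoʳ-≤ (K + 1) (bernoulli K j) ⟩
    (K + 1) * (K * (K + 1) ^ j)
      ≡⟨ solve 3 (λ K x y → (K :+ con 1) :* (K :* y) := K :* ((K :+ con 1) :* y)) refl K 0 ((K + 1) ^ j) ⟩
    K * (K + 1) ^ suc j ∎
    where open ≤-Reasoning

  2*K^K≤[K+1]^K : ∀ K' → 2 * (suc K') ^ (suc K') ≤ (suc K' + 1) ^ (suc K')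
  2*K^K≤[K+1]^K K' = *-cancelˡ-≤ K (begin
    K * (2 * K ^ K) ≡⟨ solve 2 (λ K x → K :* (con 2 :* x) := K :* x :+ K :* x) refl K (K ^ K) ⟩
    K ^ suc K + K * K ^ K ≤⟨ bernoulli K K ⟩
    K * (K + 1) ^ K ∎)
    where
    open ≤-Reasoning
    K = suc K'

  2^t*K^Kt≤[K+1]^Kt : ∀ K' t → 2 ^ t * (suc K') ^ (suc K' * t) ≤ (suc K' + 1) ^ (suc K' * t)
  2^t*K^Kt≤[K+1]^Kt K' zero rewrite *-zeroʳ K' = ≤-refl
  2^t*K^Kt≤[K+1]^Kt K' (suc t) = begin
    2 ^ suc t * K ^ (K * suc t) ≡⟨ cong (λ z → 2 ^ suc t * K ^ z) (*-suc K t) ⟩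
    2 ^ suc t * K ^ (K + K * t) ≡⟨ cong (2 ^ suc t *_) (^-distribˡ-+-* K K (K * t)) ⟩
    2 * 2 ^ t * (K ^ K * K ^ (K * t))
      ≡⟨ solve 4 (λ a b c d → con 2 :* a :* (c :* d) := (con 2 :* c) :* (a :* d)) refl (2 ^ t) 0 (K ^ K) (K ^ (K * t)) ⟩
    (2 * K ^ K) * (2 ^ t * K ^ (K * t)) ≤⟨ *-mono-≤ (2*K^K≤[K+1]^K K') (2^t*K^Kt≤[K+1]^Kt K' t) ⟩
    (K + 1) ^ K * (K + 1) ^ (K * t) ≡⟨ sym (^-distribˡ-+-* (K + 1) K (K * t)) ⟩
    (K + 1) ^ (K + K * t) ≡⟨ cong ((K + 1) ^_) (sym (*-suc K t)) ⟩
    (K + 1) ^ (K * suc t) ∎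
    where
    open ≤-Reasoning
    K = suc K'

  cube≤2^ : ∀ s → (10 + s) ^ 3 ≤ 2 ^ (10 + s)
  cube≤2^ zero = m≤m+n 1000 24
  cube≤2^ (suc s) = begin
    (11 + s) ^ 3 ≤⟨ m≤m+n _ (3 + 21 * (6 + s) + 9 * (6 + s) ^ 2 + (6 + s) ^ 3) ⟩
    (11 + s) ^ 3 + (3 + 21 * (6 + s) + 9 * (6 + s) ^ 2 + (6 + s) ^ 3)
      ≡⟨ solve 1 (λ s → (con 11 :+ s) :^ 3 :+
            (con 3 :+ con 21 :* (con 6 :+ s) :+ con 9 :* (con 6 :+ s) :^ 2 :+ (con 6 :+ s) :^ 3) := con 2 :* (con 10 :+ s) :^ 3)
           refl s ⟩
    2 * (10 + s) ^ 3 ≤⟨ *-monoʳ-≤ 2 (cube≤2^ s) ⟩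
    2 ^ (11 + s) ∎
    where open ≤-Reasoning

  square≤cube : ∀ c t → 4 * (c * c) ≤ t → 1 ≤ t → (c * (t + 1)) * (c * (t + 1)) ≤ t ^ 3
  square≤cube c t 4c²≤t t≥1 = begin
    (c * (t + 1)) * (c * (t + 1))
      ≡⟨ solve 2 (λ c t → (c :* (t :+ con 1)) :* (c :* (t :+ con 1)) := (c :* c) :* ((t :+ con 1) :* (t :+ con 1))) refl c t ⟩
    (c * c) * ((t + 1) * (t + 1)) ≤⟨ *-monoʳ-≤ (c * c) ([t+1]²≤4t² t t≥1) ⟩
    (c * c) * (4 * (t * t))
      ≡⟨ solve 2 (λ a t → a :* (con 4 :* (t :* t)) := (con 4 :* a) :* (t :* t)) refl (c * c) t ⟩
    (4 * (c * c)) * (t * t) ≤⟨ *-monoˡ-≤ (t * t) 4c²≤t ⟩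
    t * (t * t) ≡⟨ solve 1 (λ t → t :* (t :* t) := t :^ 3) refl t ⟩
    t ^ 3 ∎
    where
    open ≤-Reasoning
    [t+1]²≤4t² : ∀ t → 1 ≤ t → (t + 1) * (t + 1) ≤ 4 * (t * t)
    [t+1]²≤4t² (suc u) _ = ≤-trans (m≤m+n _ (4 * u + 3 * (u * u)))
        (≤-reflexive (solve 1 (λ u → (con 1 :+ u :+ con 1) :* (con 1 :+ u :+ con 1) :+
              (con 4 :* u :+ con 3 :* (u :* u)) := con 4 :* ((con 1 :+ u) :* (con 1 :+ u)))
                                                                                   refl u))

  module _ (K' : ℕ) where

    private
      K c T : ℕ
      K = suc K'
      c = 2 * K
      T = 10 + 4 * (c * c)

    n≡K*[n/K]+n%K : ∀ n → n ≡ K * (n / K) + n % K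
    n≡K*[n/K]+n%K n = trans (m≡m%n+[m/n]*n n K) (trans (+-comm (n % K) (n / K * K)) (cong (_+ n % K) (*-comm (n / K) K)))

    -- With t = n / K one has statRange n ≤ (c (t + 1))² ≤ t³ ≤ 2^t.
    statRange≤2^[n/K] : ∀ n → T * K ≤ n → statRange n ≤ 2 ^ (n / K)
    statRange≤2^[n/K] n T*K≤n = begin
      statRange n
        ≤⟨ s≤s (≤-trans (*-monoʳ-≤ (2 * n) (n≤1+n (2 * n))) (m≤n+m _ (2 * n))) ⟩
      suc (2 * n) * suc (2 * n)           ≤⟨ *-mono-≤ 1+2n≤c[t+1] 1+2n≤c[t+1] ⟩
      (c * (t + 1)) * (c * (t + 1))
        ≤⟨ square≤cube c t (≤-trans (m≤n+m _ 10) T≤t) (≤-trans (s≤s z≤n) T≤t) ⟩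
      t ^ 3                               ≡⟨ cong (_^ 3) (sym (m+[n∸m]≡n 10≤t)) ⟩
      (10 + (t ∸ 10)) ^ 3                 ≤⟨ cube≤2^ (t ∸ 10) ⟩
      2 ^ (10 + (t ∸ 10))                 ≡⟨ cong (2 ^_) (m+[n∸m]≡n 10≤t) ⟩
      2 ^ t                               ∎
      where
      open ≤-Reasoning
      t = n / K
      n<K*[t+1] : n < K * (t + 1)
      n<K*[t+1] = P.subst (_< K * (t + 1)) (sym (n≡K*[n/K]+n%K n))
        (P.subst (K * t + n % K <_) (sym (trans (*-distribˡ-+ K t 1) (cong (K * t +_) (*-identityʳ K))))
          (+-monoʳ-< (K * t) (m%n<n n K)))
      T≤t : T ≤ t
      T≤t with T ≤? t
      ... | yes T≤t = T≤t
      ... | no T≰t = ⊥-elim (<⇒≱ (<-≤-trans n<K*[t+1]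
            (≤-trans (*-monoʳ-≤ K (≤-trans (≤-reflexive (+-comm t 1)) (≰⇒> T≰t)))
                                                              (≤-reflexive (*-comm K T)))) T*K≤n)
      10≤t : 10 ≤ t
      10≤t = ≤-trans (m≤m+n 10 _) T≤t
      1+2n≤c[t+1] : suc (2 * n) ≤ c * (t + 1)
      1+2n≤c[t+1] = ≤-trans (≤-trans (n≤1+n (suc (2 * n))) (≤-reflexive (solve 1 (λ n → con 2 :+ con 2 :* n := con 2 :* (con 1 :+ n))
                                                                           refl n)))
                            (≤-trans (*-monoʳ-≤ 2 n<K*[t+1]) (≤-reflexive (sym (*-assoc 2 K (t + 1)))))

    statRange*K^n≤[K+1]^n : ∃ λ N → ∀ n → N ≤ n → statRange n * K ^ n ≤ (K + 1) ^ n
    statRange*K^n≤[K+1]^n = T * K , λ n T*K≤n → let t = n / K ; r = n % K in begin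
      statRange n * K ^ n                ≤⟨ *-monoˡ-≤ (K ^ n) (statRange≤2^[n/K] n T*K≤n) ⟩
      2 ^ t * K ^ n                      ≡⟨ cong (λ z → 2 ^ t * K ^ z) (n≡K*[n/K]+n%K n) ⟩
      2 ^ t * K ^ (K * t + r)            ≡⟨ cong (2 ^ t *_) (^-distribˡ-+-* K (K * t) r) ⟩
      2 ^ t * (K ^ (K * t) * K ^ r)      ≡⟨ sym (*-assoc (2 ^ t) (K ^ (K * t)) (K ^ r)) ⟩
      2 ^ t * K ^ (K * t) * K ^ r        ≤⟨ *-mono-≤ (2^t*K^Kt≤[K+1]^Kt K' t) (^-monoˡ-≤ r (m≤m+n K 1)) ⟩
      (K + 1) ^ (K * t) * (K + 1) ^ r    ≡⟨ sym (^-distribˡ-+-* (K + 1) (K * t) r) ⟩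
      (K + 1) ^ (K * t + r)              ≡⟨ cong ((K + 1) ^_) (sym (n≡K*[n/K]+n%K n)) ⟩
      (K + 1) ^ n                        ∎
      where open ≤-Reasoning

module RationalCasts where

  open import Data.Nat as ℕ using (ℕ; zero; suc; _^_)
  import Data.Nat.Properties as ℕP
  open import Data.Integer as ℤ using (+_)
  import Data.Integer.Properties as ℤP
  open import Data.Rational using (ℚ; _/_; _+_; _*_; _≤_; _<_; toℚᵘ; positive)
  open import Data.Rational.Properties
    using (toℚᵘ-injective; toℚᵘ-fromℚᵘ; toℚᵘ-homo-*; toℚᵘ-homo-+;
        toℚᵘ-cancel-≤; toℚᵘ-cancel-<; *-cancelˡ-≤-pos; module ≤-Reasoning)
  open import Data.Rational.Unnormalised using (ℚᵘ; mkℚᵘ; *≡*; *≤*; *<*) renaming (_≃_ to _≃ᵘ_)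
  import Data.Rational.Unnormalised.Properties as ᵘP
  open import Relation.Binary.PropositionalEquality using (_≡_; refl; cong; sym; trans; subst₂)
  open import Defs using (ℕtoℚ; powℚ)
  import Data.Rational.Solver as ℚSolver
  import Data.Integer.Solver as ℤSolver

  fracᵘ : ℕ → ℕ → ℚᵘ
  fracᵘ a d = mkℚᵘ (+ a) d

  toℚᵘ-fracᵘ : ∀ a d → toℚᵘ (+ a / suc d) ≃ᵘ fracᵘ a d
  toℚᵘ-fracᵘ a d = toℚᵘ-fromℚᵘ (fracᵘ a d)

  ℕtoℚ-* : ∀ a b → ℕtoℚ (a ℕ.* b) ≡ ℕtoℚ a * ℕtoℚ b
  ℕtoℚ-* a b = toℚᵘ-injective (ᵘP.≃-trans (toℚᵘ-fracᵘ (a ℕ.* b) 0)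
    (ᵘP.≃-trans (ᵘP.≃-reflexive (cong (λ z → mkℚᵘ z 0) (ℤP.pos-* a b)))
    (ᵘP.≃-sym (ᵘP.≃-trans (toℚᵘ-homo-* (ℕtoℚ a) (ℕtoℚ b)) (ᵘP.*-cong (toℚᵘ-fracᵘ a 0) (toℚᵘ-fracᵘ b 0))))))

  fraction-≤ : ∀ a b m k → a ℕ.* suc k ℕ.≤ b ℕ.* suc m → + a / suc m ≤ + b / suc k
  fraction-≤ a b m k h = toℚᵘ-cancel-≤ (ᵘP.≤-respˡ-≃ (ᵘP.≃-sym (toℚᵘ-fracᵘ a m))
      (ᵘP.≤-respʳ-≃ (ᵘP.≃-sym (toℚᵘ-fracᵘ b k))
    (*≤* (subst₂ ℤ._≤_ (ℤP.pos-* a (suc k)) (ℤP.pos-* b (suc m)) (ℤ.+≤+ h)))))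

  fraction-< : ∀ a b m k → a ℕ.* suc k ℕ.< b ℕ.* suc m → + a / suc m < + b / suc k
  fraction-< a b m k h = toℚᵘ-cancel-< (ᵘP.<-respˡ-≃ (ᵘP.≃-sym (toℚᵘ-fracᵘ a m))
      (ᵘP.<-respʳ-≃ (ᵘP.≃-sym (toℚᵘ-fracᵘ b k))
    (*<* (subst₂ ℤ._<_ (ℤP.pos-* a (suc k)) (ℤP.pos-* b (suc m)) (ℤ.+<+ h)))))

  ℕtoℚ-mono-≤ : ∀ {a b} → a ℕ.≤ b → ℕtoℚ a ≤ ℕtoℚ b
  ℕtoℚ-mono-≤ {a} {b} a≤b = fraction-≤ a b 0 0 (ℕP.*-monoˡ-≤ 1 a≤b)

  ℕtoℚ-mono-< : ∀ {a b} → a ℕ.< b → ℕtoℚ a < ℕtoℚ b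
  ℕtoℚ-mono-< {a} {b} a<b = fraction-< a b 0 0 (ℕP.*-monoˡ-< 1 a<b)

  powℚ-ℕtoℚ : ∀ a n → powℚ (ℕtoℚ a) n ≡ ℕtoℚ (a ^ n)
  powℚ-ℕtoℚ a zero = refl
  powℚ-ℕtoℚ a (suc n) = trans (cong (ℕtoℚ a *_) (powℚ-ℕtoℚ a n)) (sym (ℕtoℚ-* a (a ^ n)))

  powℚ-* : ∀ p q n → powℚ (p * q) n ≡ powℚ p n * powℚ q n
  powℚ-* p q zero = refl
  powℚ-* p q (suc n) = trans (cong ((p * q) *_) (powℚ-* p q n))
    (solve 4 (λ a b c d → (a :* b) :* (c :* d) := (a :* c) :* (b :* d)) refl p q (powℚ p n) (powℚ q n))
    where open ℚSolver.+-*-Solver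

  m*[a+b/m]≡a*m+b : ∀ a b m' → ℕtoℚ (suc m') * (+ a / 1 + + b / suc m') ≡ ℕtoℚ (a ℕ.* suc m' ℕ.+ b)
  m*[a+b/m]≡a*m+b a b m' = toℚᵘ-injective (ᵘP.≃-trans (toℚᵘ-homo-* (ℕtoℚ m) (+ a / 1 + + b / m))
    (ᵘP.≃-trans (ᵘP.*-cong (toℚᵘ-fracᵘ m 0) (ᵘP.≃-trans (toℚᵘ-homo-+ (+ a / 1) (+ b / m))
        (ᵘP.+-cong (toℚᵘ-fracᵘ a 0) (toℚᵘ-fracᵘ b m'))))
    (ᵘP.≃-trans (*≡* cross-multiplied) (ᵘP.≃-sym (toℚᵘ-fracᵘ (a ℕ.* m ℕ.+ b) 0)))))
    where
    open ℤSolver.+-*-Solver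
    m = suc m'
    +[a*m+b] : + (a ℕ.* m ℕ.+ b) ≡ + a ℤ.* + m ℤ.+ + b
    +[a*m+b] = trans (ℤP.pos-+ (a ℕ.* m) b) (cong (ℤ._+ + b) (ℤP.pos-* a m))
    cross-multiplied : (+ m ℤ.* (+ a ℤ.* + m ℤ.+ + b ℤ.* + 1)) ℤ.* + 1 ≡ + (a ℕ.* m ℕ.+ b) ℤ.* (+ 1 ℤ.* (+ 1 ℤ.* + m))
    cross-multiplied = trans
      (solve 3 (λ M A B → (M :* (A :* M :+ B :* con (+ 1))) :* con (+ 1) := (A :* M :+ B) :* (con (+ 1) :* (con (+ 1) :* M)))
         refl (+ m) (+ a) (+ b))
      (cong (ℤ._* (+ 1 ℤ.* (+ 1 ℤ.* + m))) (sym +[a*m+b]))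

  bound-from-ℕ : ∀ X Y m' N (r : ℚ) n → ℕtoℚ (suc m') * r ≡ ℕtoℚ N → X ℕ.* suc m' ^ n ℕ.≤ Y ℕ.* N ^ n →
    ℕtoℚ X ≤ ℕtoℚ Y * powℚ r n
  bound-from-ℕ X Y m' N r n m*r≡N X*m^n≤Y*N^n = *-cancelˡ-≤-pos M {{positive (ℕtoℚ-mono-< (ℕP.m^n>0 (suc m') n))}} (begin
    M * ℕtoℚ X                    ≡⟨ sym (ℕtoℚ-* (suc m' ^ n) X) ⟩
    ℕtoℚ (suc m' ^ n ℕ.* X)
      ≤⟨ ℕtoℚ-mono-≤ (ℕP.≤-trans (ℕP.≤-reflexive (ℕP.*-comm (suc m' ^ n) X)) X*m^n≤Y*N^n) ⟩
    ℕtoℚ (Y ℕ.* N ^ n)            ≡⟨ ℕtoℚ-* Y (N ^ n) ⟩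
    ℕtoℚ Y * ℕtoℚ (N ^ n)         ≡⟨ cong (ℕtoℚ Y *_) (sym M*r^n≡N^n) ⟩
    ℕtoℚ Y * (M * powℚ r n)
      ≡⟨ solve 3 (λ y a b → y :* (a :* b) := a :* (y :* b)) refl (ℕtoℚ Y) M (powℚ r n) ⟩
    M * (ℕtoℚ Y * powℚ r n)       ∎)
    where
    open ≤-Reasoning
    open ℚSolver.+-*-Solver using (solve; _:*_; _:=_)
    M : ℚ
    M = ℕtoℚ (suc m' ^ n)
    M*r^n≡N^n : M * powℚ r n ≡ ℕtoℚ (N ^ n)
    M*r^n≡N^n = begin-equality
      M * powℚ r n                        ≡⟨ cong (_* powℚ r n) (sym (powℚ-ℕtoℚ (suc m') n)) ⟩
      powℚ (ℕtoℚ (suc m')) n * powℚ r n   ≡⟨ sym (powℚ-* (ℕtoℚ (suc m')) r n) ⟩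
      powℚ (ℕtoℚ (suc m') * r) n          ≡⟨ cong (λ z → powℚ z n) m*r≡N ⟩
      powℚ (ℕtoℚ N) n                     ≡⟨ powℚ-ℕtoℚ N n ⟩
      ℕtoℚ (N ^ n)                        ∎

module Epsilon where

  open import Data.Nat using (ℕ; zero; suc; _+_; _*_; _^_; _≤_; z≤n; s≤s; _≤?_; _⊔_)
  open import Data.Nat.Properties
  open import Data.Integer using (+_)
  open import Data.Rational using (ℚ; _/_; 0ℚ) renaming (_+_ to _+ℚ_; _*_ to _*ℚ_; _≤_ to _≤ℚ_; _<_ to _<ℚ_)
  open import Data.Rational.Properties using (nonNegative⁻¹; normalize-nonNeg)
  open import Data.Product using (∃; _,_; proj₁; proj₂)
  open import Data.Sum using (inj₁; inj₂)
  open import Data.Empty using (⊥-elim)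
  open import Relation.Binary.PropositionalEquality using (_≡_; refl; cong; sym; trans)
  open import Relation.Nullary using (yes; no)
  open import Defs using (ℕtoℚ; powℚ)
  open import Data.Nat.Solver using (module +-*-Solver)
  open Growth
  open RationalCasts

  search : ℕ → ℕ → ℕ
  search n zero = 0
  search n (suc u) with statRange n * suc u ^ n ≤? (suc u + 1) ^ n
  ... | yes _ = suc u
  ... | no _ = search n u

  search-sound : ∀ n u m' → search n u ≡ suc m' → statRange n * suc m' ^ n ≤ (suc m' + 1) ^ n
  search-sound n (suc u) m' e with statRange n * suc u ^ n ≤? (suc u + 1) ^ n
  search-sound n (suc u) m' refl | yes found = found
  ... | no _ = search-sound n u m' e

  search-maximal : ∀ n u k → statRange n * suc k ^ n ≤ (suc k + 1) ^ n → suc k ≤ u → suc k ≤ search n u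
  search-maximal n (suc u) k holds k<1+u with statRange n * suc u ^ n ≤? (suc u + 1) ^ n
  ... | yes _ = k<1+u
  ... | no fails with m≤n⇒m<n∨m≡n k<1+u
  ...   | inj₁ (s≤s k<u) = search-maximal n u k holds k<u
  ...   | inj₂ refl = ⊥-elim (fails holds)

  statRange≤[1+statRange]^n : ∀ n → statRange n * 1 ^ n ≤ (1 + statRange n) ^ n
  statRange≤[1+statRange]^n zero = s≤s z≤n
  statRange≤[1+statRange]^n (suc n) = begin
    statRange (suc n) * 1 ^ suc n
      ≡⟨ trans (cong (statRange (suc n) *_) (^-zeroˡ (suc n))) (*-identityʳ _) ⟩
    statRange (suc n)                      ≤⟨ n≤1+n _ ⟩
    1 + statRange (suc n)                  ≡⟨ sym (*-identityʳ _) ⟩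
    (1 + statRange (suc n)) * 1
      ≤⟨ *-monoʳ-≤ (1 + statRange (suc n)) (m^n>0 (1 + statRange (suc n)) n) ⟩
    (1 + statRange (suc n)) ^ suc n        ∎
    where open ≤-Reasoning

  record Scale (n : ℕ) : Set where
    field
      m' c : ℕ
      sound : statRange n * suc m' ^ n ≤ (suc m' + c) ^ n

  scaleFrom : ∀ n v → search n n ≡ v → Scale n
  scaleFrom n zero _ = record { m' = 0 ; c = statRange n ; sound = statRange≤[1+statRange]^n n }
  scaleFrom n (suc m') e = record { m' = m' ; c = 1 ; sound = search-sound n n m' e }

  scale : ∀ n → Scale n
  scale n = scaleFrom n (search n n) refl

  -- With scale n = (m, c) we have (1 + c / m)ⁿ ≥ statRange n, and
  -- c / m → 0 because m = search n n grows without bound.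
  ε : ℕ → ℚ
  ε n = + (4 * c) / suc m' where open Scale (scale n)

  ε-nonNegative : ∀ n → 0ℚ ≤ℚ ε n
  ε-nonNegative n = nonNegative⁻¹ (ε n) {{normalize-nonNeg (4 * c) (suc m')}}
    where open Scale (scale n)

  ε-bound : ∀ a → a ≤ 4 → ∀ n X Y → X ≤ Y * (statRange n * a ^ n) →
    ℕtoℚ X ≤ℚ ℕtoℚ Y *ℚ powℚ (+ a / 1 +ℚ ε n) n
  ε-bound a a≤4 n X Y X≤Y*S*aⁿ =
    bound-from-ℕ X Y m' (a * suc m' + 4 * c) (+ a / 1 +ℚ ε n) n (m*[a+b/m]≡a*m+b a (4 * c) m') (begin
      X * suc m' ^ n                                 ≤⟨ *-monoˡ-≤ (suc m' ^ n) X≤Y*S*aⁿ ⟩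
      Y * (statRange n * a ^ n) * suc m' ^ n
        ≡⟨ solve 4 (λ y s p q → y :* (s :* p) :* q := y :* (p :* (s :* q))) refl Y (statRange n) (a ^ n) (suc m' ^ n) ⟩
      Y * (a ^ n * (statRange n * suc m' ^ n))       ≤⟨ *-monoʳ-≤ Y (*-monoʳ-≤ (a ^ n) sound) ⟩
      Y * (a ^ n * (suc m' + c) ^ n)                 ≡⟨ cong (Y *_) (sym (*-^-distrib a (suc m' + c) n)) ⟩
      Y * (a * (suc m' + c)) ^ n                     ≤⟨ *-monoʳ-≤ Y (^-monoˡ-≤ n a[m+c]≤am+4c) ⟩
      Y * (a * suc m' + 4 * c) ^ n                   ∎)
    where
    open Scale (scale n)
    open ≤-Reasoning
    open +-*-Solver using (solve; _:*_; _:=_)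
    a[m+c]≤am+4c : a * (suc m' + c) ≤ a * suc m' + 4 * c
    a[m+c]≤am+4c = ≤-trans (≤-reflexive (*-distribˡ-+ a (suc m') c)) (+-monoʳ-≤ (a * suc m') (*-monoˡ-≤ c a≤4))

  ε→0 : ∀ (k : ℕ) → ∃ λ N → ∀ n → N ≤ n → ε n <ℚ + 1 / suc k
  ε→0 k = N ⊔ suc K' , λ n N≤n → small n (search n n) refl
    (search-maximal n n K' (proj₂ (statRange*K^n≤[K+1]^n K') n (≤-trans (m≤m⊔n N (suc K')) N≤n))
                           (≤-trans (m≤n⊔m N (suc K')) N≤n))
    where
    K' = 4 * suc k
    N = proj₁ (statRange*K^n≤[K+1]^n K')
    small : ∀ n v (e : search n n ≡ v) → suc K' ≤ v →
      + (4 * Scale.c (scaleFrom n v e)) / suc (Scale.m' (scaleFrom n v e)) <ℚ + 1 / suc k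
    small n (suc m') e (s≤s K'≤m') = fraction-< 4 1 m' k (≤-trans (s≤s K'≤m') (≤-reflexive (sym (*-identityˡ (suc m')))))

module SimilarityClasses where

  open import Data.Nat using (ℕ; suc; _+_; _*_; _^_; _<_; _≤_; s≤s)
  open import Data.Nat.Properties
  open import Data.Bool using (Bool)
  open import Data.List using (List; []; _∷_; _++_; map; length; upTo; concatMap)
  open import Data.List.Properties using (length-++; length-map; length-upTo; ∷-injective)
  open import Data.List.Membership.Propositional using (_∈_)
  open import Data.List.Membership.Propositional.Properties using (∈-map⁺; ∈-upTo⁺; ∈-concatMap⁺)
  open import Data.List.Relation.Unary.Any as Any using ()
  open import Data.List.Relation.Binary.Permutation.Propositional using (_↭_; prep; ↭-sym; ↭-trans; ↭-reflexive; module PermutationReasoning)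
  open import Data.List.Relation.Binary.Permutation.Propositional.Properties using (++⁺; ∈-resp-↭; ↭-length; map⁺)
  open import Data.List.Relation.Unary.Linked.Properties using (Linked⇒AllPairs)
  open import Data.List.Sort ≤-decTotalOrder using (sort; sort-↭; sort-↗)
  open import Data.Product using (proj₁; proj₂)
  open import Relation.Binary.PropositionalEquality using (_≡_; refl; cong; cong₂; sym; trans; subst; module ≡-Reasoning)
  open import Defs using (IsMatching; cr; ne; CrossingSimilar; NestingSimilar)
  open FiniteSums using (∑-bounded; ∑-iverson≤)
  open Children using (pairCount; crosses; nests; cr≡pairCount; ne≡pairCount; heights; closedProfile)
  open StepSequences
  open MatchingProfiles
  open Descendants using (crossingSimilar; nestingSimilar)
  open Growth using (statRange)

  prefixed : List ℕ → List (List ℕ) → List (List ℕ)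
  prefixed es S = concatMap (λ e → map (e ∷_) S) es

  length-prefixed : ∀ es S → length (prefixed es S) ≡ length es * length S
  length-prefixed [] S = refl
  length-prefixed (e ∷ es) S = trans (length-++ (map (e ∷_) S)) (cong₂ _+_ (length-map (e ∷_) S) (length-prefixed es S))

  ∈-prefixed : ∀ {e es x S} → e ∈ es → x ∈ S → (e ∷ x) ∈ prefixed es S
  ∈-prefixed {e} {S = S} e∈ x∈ = ∈-concatMap⁺ (λ e′ → map (e′ ∷_) S) (Any.map (λ { refl → ∈-map⁺ (e ∷_) x∈ }) e∈)

  pairCount≤ : ∀ (P : ℕ → ℕ → Bool) m → pairCount P m ≤ m * m
  pairCount≤ P m = ∑-bounded m m _ (λ i → ∑-iverson≤ m (P i))

  crossingCode nestingCode : List ℕ → List ℕ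
  crossingCode L = cr L ∷ sort (openerHeights L)
  nestingCode L = ne L ∷ closedProfile L

  crossingCodes nestingCodes : ℕ → List (List ℕ)
  crossingCodes n = prefixed (upTo (statRange n)) (stepSeqs₀ n)
  nestingCodes n = prefixed (upTo (statRange n)) (stepSeqs 0 (2 * n))

  length-crossingCodes : ∀ n → length (crossingCodes n) ≤ statRange n * 2 ^ n
  length-crossingCodes n = ≤-trans (≤-reflexive (length-prefixed (upTo (statRange n)) (stepSeqs₀ n)))
    (≤-trans (≤-reflexive (cong (_* length (stepSeqs₀ n)) (length-upTo (statRange n))))
             (*-monoʳ-≤ (statRange n) (length-stepSeqs₀ n)))

  length-nestingCodes : ∀ n → length (nestingCodes n) ≤ statRange n * 4 ^ n
  length-nestingCodes n = ≤-reflexive (begin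
    length (nestingCodes n)
      ≡⟨ length-prefixed (upTo (statRange n)) (stepSeqs 0 (2 * n)) ⟩
    length (upTo (statRange n)) * length (stepSeqs 0 (2 * n))
                                                 ≡⟨ cong₂ _*_ (length-upTo (statRange n)) (length-stepSeqs 0 (2 * n)) ⟩
    statRange n * 2 ^ (2 * n)                    ≡⟨ cong (statRange n *_) (sym (^-*-assoc 2 2 n)) ⟩
    statRange n * 4 ^ n                          ∎)
    where open ≡-Reasoning

  module _ (n : ℕ) where

    pairCount<statRange : ∀ (P : List ℕ → ℕ → ℕ → Bool) L → IsMatching n L → pairCount (P L) (length L) < statRange n
    pairCount<statRange P L M rewrite proj₁ M = s≤s (pairCount≤ (P L) (2 * n))

    crossingCode∈ : ∀ L → IsMatching n L → crossingCode L ∈ crossingCodes n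
    crossingCode∈ L M = ∈-prefixed (∈-upTo⁺ (subst (_< statRange n) (sym (cr≡pairCount L)) (pairCount<statRange crosses L M)))
      (subst (λ k → sort (openerHeights L) ∈ stepSeqs₀ k)
          (trans (↭-length (sort-↭ (openerHeights L))) (Matching.length-openerHeights n L M))
        (sorted∈stepSeqs₀ (sort (openerHeights L)) (Linked⇒AllPairs ≤-trans (sort-↗ (openerHeights L)))
          (λ u v u∈ v<u → ∈-resp-↭ (↭-sym (sort-↭ (openerHeights L)))
            (Matching.openerHeights-downClosed n L M u v (∈-resp-↭ (sort-↭ (openerHeights L)) u∈) v<u))))

    nestingCode∈ : ∀ L → IsMatching n L → nestingCode L ∈ nestingCodes n
    nestingCode∈ L M = ∈-prefixed (∈-upTo⁺ (subst (_< statRange n) (sym (ne≡pairCount L)) (pairCount<statRange nests L M)))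
      (subst (λ k → closedProfile L ∈ stepSeqs 0 k) (proj₁ M) (Matching.closedProfile∈stepSeqs n L M))

    crossingSimilar-by-code : ∀ L K → IsMatching n L → IsMatching n K → crossingCode L ≡ crossingCode K → CrossingSimilar L K
    crossingSimilar-by-code L K ML MK code≡ = crossingSimilar L K (proj₁ (∷-injective code≡)) (begin
      heights L                                               ↭⟨ Matching.heights↭ n L ML ⟩
      0 ∷ (map suc (openerHeights L) ++ openerHeights L)      ↭⟨ prep 0 (++⁺ (map⁺ suc openers↭) openers↭) ⟩
      0 ∷ (map suc (openerHeights K) ++ openerHeights K)      ↭⟨ ↭-sym (Matching.heights↭ n K MK) ⟩
      heights K                                               ∎)
      where
      open PermutationReasoning
      openers↭ : openerHeights L ↭ openerHeights K
      openers↭ = ↭-trans (↭-sym (sort-↭ (openerHeights L)))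
        (↭-trans (↭-reflexive (proj₂ (∷-injective code≡))) (sort-↭ (openerHeights K)))

    nestingSimilar-by-code : ∀ L K → IsMatching n L → IsMatching n K → nestingCode L ≡ nestingCode K → NestingSimilar L K
    nestingSimilar-by-code L K _ _ code≡ = nestingSimilar L K (proj₁ (∷-injective code≡)) (proj₂ (∷-injective code≡))

module LargeClasses where

  open import Data.Nat using (ℕ; _*_; _^_; _≤_)
  open import Data.Nat.Properties using (≤-trans; ≤-reflexive; *-monoˡ-≤; *-comm)
  open import Data.List using (List; length)
  open import Data.List.Membership.Propositional using (_∈_)
  open import Data.List.Relation.Unary.All as All using (All)
  open import Data.List.Relation.Unary.AllPairs using (AllPairs)
  open import Data.List.Relation.Unary.Unique.Propositional using (Unique)
  open import Data.Integer using (+_)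
  open import Data.Rational using (_/_) renaming (_+_ to _+ℚ_; _*_ to _*ℚ_; _≤_ to _≤ℚ_)
  open import Data.Product using (∃; _×_; _,_)
  open import Relation.Binary.PropositionalEquality using (_≡_)
  open import Defs using (IsMatching; ℕtoℚ; powℚ)
  open Growth using (statRange)
  open Pigeonhole using (similarClass)
  open Epsilon using (ε; ε-bound)

  largeClass : ∀ a → a ≤ 4 → (R : List ℕ → List ℕ → Set) (code : List ℕ → List ℕ) (codes : ℕ → List (List ℕ)) →
    (∀ n → length (codes n) ≤ statRange n * a ^ n) →
    (∀ n L → IsMatching n L → code L ∈ codes n) →
    (∀ n L K → IsMatching n L → IsMatching n K → code L ≡ code K → R L K) →
    ∀ n X → All (IsMatching n) X → Unique X →
    ∃ λ Y → Unique Y × All (_∈ X) Y × AllPairs R Y ×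
            ℕtoℚ (length X) ≤ℚ ℕtoℚ (length Y) *ℚ powℚ (+ a / 1 +ℚ ε n) n
  largeClass a a≤4 R code codes length-codes code∈ similar n X valid distinct
    with similarClass code (IsMatching n) R (codes n) X valid distinct (similar n) (All.map (λ {L} → code∈ n L) valid)
  ... | Y , distinctY , Y⊆X , similarY , X≤codes*Y =
    Y , distinctY , Y⊆X , similarY ,
    ε-bound a a≤4 n (length X) (length Y)
      (≤-trans X≤codes*Y (≤-trans (*-monoˡ-≤ (length Y) (length-codes n)) (≤-reflexive (*-comm _ (length Y)))))

open import Defs
open import Data.Nat using (ℕ; suc; s≤s; z≤n)
open import Data.List using (List; length)
open import Data.List.Relation.Unary.All using (All)
open import Data.List.Relation.Unary.AllPairs using (AllPairs)
open import Data.List.Relation.Unary.Unique.Propositional using (Unique)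
open import Data.List.Membership.Propositional using (_∈_)
open import Data.Integer using (+_)
open import Data.Rational using (ℚ; _/_; _+_; _≤_; _<_; 0ℚ)
open import Data.Product using (Σ; ∃; _×_; _,_)
open import Data.Nat.Properties using (≤-refl)
open Epsilon using (ε-nonNegative; ε→0)
open SimilarityClasses
open LargeClasses using (largeClass)

corollary4p2 :
    Σ (ℕ → ℚ) λ ε →
      (∀ n → 0ℚ ≤ ε n) ×
      (∀ (k : ℕ) → ∃ λ N → ∀ n → N Data.Nat.≤ n → ε n < + 1 / suc k) ×
      (∀ (n : ℕ) (X : List (List ℕ)) → All (IsMatching n) X → Unique X →
        (∃ λ (Y : List (List ℕ)) → Unique Y × All (_∈ X) Y ×
           AllPairs CrossingSimilar Y ×
           ℕtoℚ (length X) ≤ ℕtoℚ (length Y) Data.Rational.* powℚ (+ 2 / 1 + ε n) n) ×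
        (∃ λ (Y : List (List ℕ)) → Unique Y × All (_∈ X) Y ×
           AllPairs NestingSimilar Y ×
           ℕtoℚ (length X) ≤ ℕtoℚ (length Y) Data.Rational.* powℚ (+ 4 / 1 + ε n) n))
corollary4p2 = Epsilon.ε , ε-nonNegative , ε→0 , λ n X valid distinct →
  largeClass 2 (s≤s (s≤s z≤n)) CrossingSimilar crossingCode crossingCodes
    length-crossingCodes crossingCode∈ crossingSimilar-by-code n X valid distinct ,
  largeClass 4 ≤-refl NestingSimilar nestingCode nestingCodes
    length-nestingCodes nestingCode∈ nestingSimilar-by-code n X valid distinct
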